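{- Let $m\ge1$, $k\ge1$ and $h\le k-1$ be integers. The generating function for the number of partitions $\lambda$ of $n$ into odd parts with an $h$-fixed hook in the $m$th column that arises from a hook of size $k$ (i.e. the row $s=k-h$ satisfies $\lambda_s\ge m$ and $h_{s,m}(\lambda)=k$) is \[ \sum_{\substack{l=1\\ l\ \mathrm{odd}}}^{k}\frac{q^{k+l(k-h-1)+(m-1)(2k-h-l)}}{(q^2;q^2)_{k-h-1}(q;q^2)_{(m-1)/2}}\binom{k-l+(l-1)/2}{k-l}_{q^2} \] if $m$ is odd, and \[ \sum_{\substack{l=1\\ l\ \mathrm{even}}}^{k}\frac{q^{k+l(k-h-1)+(m-1)(2k-h-l)+(k-l)}}{(q^2;q^2)_{k-h-1}(q;q^2)_{m/2}}\binom{k-l+(l-2)/2}{k-l}_{q^2} \] if $m$ is even.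
   Context: For a partition $\lambda$ with conjugate $\lambda'$, $h_{i,j}(\lambda)=\lambda_i+\lambda'_j-i-j+1$ is the hook length of cell $(i,j)$, $j\le\lambda_i$. An $h$-fixed hook in the $m$th column is a row $i$ with $\lambda_i\ge m$ and $h_{i,m}(\lambda)=i+h$. Notation: $(a;b)_n=\prod_{t=0}^{n-1}(1-ab^t)$, and $\binom{a}{b}_{q^2}$ is the Gaussian binomial coefficient $\frac{(q;q)_a}{(q;q)_b(q;q)_{a-b}}$ with $q$ replaced by $q^2$. -}

module Defs where

open import Data.Nat using (ℕ; zero; suc; _+_; _*_; _∸_; _≤_; _≤?_; _%_; _/_)
open import Data.Nat.Divisibility using (_∣?_)
open import Data.Integer as ℤ using (ℤ; +_)
open import Data.List using (List; []; _∷_; length; filter; map; foldr; upTo)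
open import Data.Nat.ListAction using (sum)
open import Data.List.Relation.Unary.All using (All)
open import Data.List.Relation.Unary.Linked using (Linked)
open import Data.Product using (Σ; _×_)
open import Relation.Binary.PropositionalEquality using (_≡_)
open import Relation.Nullary.Decidable using (does)
open import Data.Bool using (if_then_else_)

IsPartitionOf : ℕ → List ℕ → Set
IsPartitionOf n ps = Linked (λ a b → b ≤ a) ps × All (1 ≤_) ps × sum ps ≡ n

OddParts : List ℕ → Set
OddParts ps = All (λ a → a % 2 ≡ 1) ps

-- λ_i, rows indexed from 1; λ_i = 0 beyond the last part
row : List ℕ → ℕ → ℕ
row []       _             = 0
row (x ∷ xs) zero          = 0
row (x ∷ xs) (suc zero)    = x
row (x ∷ xs) (suc (suc i)) = row xs (suc i)

col : List ℕ → ℕ → ℕ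
col ps j = length (filter (j ≤?_) ps)

-- h_{i,j}(λ) = λ_i + λ'_j - i - j + 1  (for cells (i,j) of the diagram)
hookLength : List ℕ → ℕ → ℕ → ℕ
hookLength ps i j = (row ps i + col ps j + 1) ∸ (i + j)

HookAt : (m s k : ℕ) → List ℕ → Set
HookAt m s k ps = 1 ≤ s × m ≤ row ps s × hookLength ps s m ≡ k

-- s = k - h as a natural number (meaningful when h ≤ k - 1)
sOf : ℕ → ℤ → ℕ
sOf k h = ℤ.∣ + k ℤ.- h ∣

HookParts : (m k : ℕ) → ℤ → ℕ → Set
HookParts m k h n =
  Σ (List ℕ) λ ps → IsPartitionOf n ps × OddParts ps × HookAt m (sOf k h) k ps

PS : Set
PS = ℕ → ℤ

sumℤ : List ℤ → ℤ
sumℤ = foldr ℤ._+_ (+ 0)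

zeroPS : PS
zeroPS _ = + 0

onePS : PS
onePS zero    = + 1
onePS (suc _) = + 0

_⊕_ : PS → PS → PS
(f ⊕ g) n = f n ℤ.+ g n

_⊛_ : PS → PS → PS
(f ⊛ g) n = sumℤ (map (λ i → f i ℤ.* g (n ∸ i)) (upTo (suc n)))

mono : ℕ → PS
mono a n = if does (a Data.Nat.≟ n) then + 1 else + 0

oneMinus : ℕ → PS
oneMinus a = λ n → onePS n ℤ.- mono a n

-- 1 / (1 - q^a) = Σ_j q^{a j}   (for a ≥ 1)
invOneMinus : ℕ → PS
invOneMinus a n = if does (a ∣? n) then + 1 else + 0

prodPS : List PS → PS
prodPS = foldr _⊛_ onePS

poch : (c d r : ℕ) → PS
poch c d r = prodPS (map (λ t → oneMinus (c + d * t)) (upTo r))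

-- 1 / (q^c ; q^d)_r = ∏_{t=0}^{r-1} 1/(1 - q^{c + d t})   (for c ≥ 1)
invPoch : (c d r : ℕ) → PS
invPoch c d r = prodPS (map (λ t → invOneMinus (c + d * t)) (upTo r))

gauss2 : ℕ → ℕ → PS
gauss2 a b = poch 2 2 a ⊛ (invPoch 2 2 b ⊛ invPoch 2 2 (a ∸ b))

sumPS : List PS → PS
sumPS = foldr _⊕_ zeroPS

range1 : ℕ → List ℕ
range1 k = map suc (upTo k)

-- odd-m generating function, with s = k - h, so k - h - 1 = s - 1 and
-- 2k - h - l = k + s - l
oddGF : (m k s : ℕ) → PS
oddGF m k s = sumPS (map term (filter (λ l → l % 2 Data.Nat.≟ 1) (range1 k)))
  where
  term : ℕ → PS
  term l = mono (k + l * (s ∸ 1) + (m ∸ 1) * ((k + s) ∸ l))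
           ⊛ (invPoch 2 2 (s ∸ 1) ⊛ (invPoch 1 2 ((m ∸ 1) / 2)
           ⊛ gauss2 ((k ∸ l) + (l ∸ 1) / 2) (k ∸ l)))

evenGF : (m k s : ℕ) → PS
evenGF m k s = sumPS (map term (filter (λ l → l % 2 Data.Nat.≟ 0) (range1 k)))
  where
  term : ℕ → PS
  term l = mono (k + l * (s ∸ 1) + (m ∸ 1) * ((k + s) ∸ l) + (k ∸ l))
           ⊛ (invPoch 2 2 (s ∸ 1) ⊛ (invPoch 1 2 (m / 2)
           ⊛ gauss2 ((k ∸ l) + (l ∸ 2) / 2) (k ∸ l)))

-- Cut a partition λ into odd parts at its row s = k − h, whose part is an odd number 2(M + L) + 1,
-- where M = ⌊m/2⌋, so that the odd parts reaching column m are exactly those ≥ 2M + 1. The s − 1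
-- parts above row s are 2(M + L + μᵢ) + 1 for a decreasing tuple μ, contributing 1/(q²;q²)_{s−1}.
-- Row s contributes l = 2(M + L) + 2 − m cells to the hook at (s, m), so exactly k − l rows below
-- it reach column m; they are 2(M + νᵢ) + 1 with L ≥ ν₁ ≥ … ≥ ν_{k−l}, giving the Gaussian
-- binomial [k − l + L, k − l]_{q²}. The remaining parts are arbitrary odd parts < 2M + 1, giving
-- 1/(q;q²)_M, and the fixed minimal parts give the power of q. Summing this weight-preserving
-- bijection over L, i.e. over the l ≡ m (mod 2), yields both formulas.

{-# OPTIONS --safe #-}
module Submission where

open import Defs
open import Data.Nat using (ℕ; _≤_; _%_)
open import Data.Integer as ℤ using (ℤ; +_)
open import Data.Fin using (Fin)
open import Data.Product using (Σ; _×_; _,_; proj₁; proj₂)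
open import Function.Bundles using (_↔_; mk↔ₛ′; mk⤖; Inverse)
open import Relation.Binary.PropositionalEquality using (_≡_; refl; sym; trans; cong; cong₂; subst; module ≡-Reasoning)

open import Algebra.Bundles using (CommutativeMonoid)
open import Algebra.Structures using (IsCommutativeMonoid)
import Algebra.Properties.CommutativeSemigroup as CommutativeSemigroupProperties
open import Data.Bool using (true; false; if_then_else_)
import Data.Fin as Fin
import Data.Fin.Properties as Fin
import Data.Integer.Properties as ℤ
open import Data.Integer.Tactic.RingSolver using (solve-∀)
open import Data.List using (List; []; _∷_; [_]; _∷ʳ_; _++_; length; replicate; map; filter; take; drop; takeWhile; dropWhile; applyUpTo; upTo)
open import Data.List.Properties
  using (∷-injective; ∷-injectiveˡ; ∷-injectiveʳ; ++-identityʳ; length-++; length-map; length-replicate; map-++; map-cong; map-∘;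
         map-injective; map-applyUpTo; map-upTo; upTo-∷ʳ; filter-++; filter-all; filter-accept; filter-none; takeWhile++dropWhile)
open import Data.List.Relation.Unary.All as All using (All; []; _∷_)
import Data.List.Relation.Unary.All.Properties as Allₚ
open import Data.List.Relation.Unary.AllPairs as AllPairs using (AllPairs; []; _∷_)
import Data.List.Relation.Unary.AllPairs.Properties as AllPairsₚ
open import Data.List.Relation.Unary.Linked as Linked using (Linked; []; [-]; _∷_)
import Data.List.Relation.Unary.Linked.Properties as Linkedₚ
open import Data.Nat as ℕ using (zero; suc; _+_; _*_; _∸_; _<_; _≥_; _/_; z≤n; s≤s)
open import Data.Nat.Divisibility using (_∣?_; divides; ∣m+n∣m⇒∣n; ∣m∣n⇒∣m+n; ∣-refl; _∣0; ∣⇒≤)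
open import Data.Nat.DivMod using (m≡m%n+[m/n]*n; [m+kn]%n≡m%n; m*n/n≡m; m*n%n≡0; /-monoˡ-≤)
open import Data.Nat.ListAction using (sum)
open import Data.Nat.ListAction.Properties using (sum-++)
import Data.Nat.Properties as ℕ
open import Data.Nat.Tactic.RingSolver using () renaming (solve-∀ to ℕ-solve-∀)
open import Data.Product.Function.Dependent.Propositional using (Σ-↔)
open import Data.Product.Function.NonDependent.Propositional using (_×-↔_)
open import Data.Sum using (_⊎_; inj₁; inj₂; [_,_]′)
open import Data.Sum.Function.Propositional using (_⊎-↔_)
open import Data.Unit using (⊤; tt)
open import Function using (_∘_; id)
open import Function.Consequences.Propositional using (strictlySurjective⇒surjective)
open import Function.Definitions using (Injective; StrictlySurjective)
open import Function.Properties.Bijection using (⤖⇒↔)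
open import Function.Properties.Inverse using (↔-trans; ↔-refl)
open import Level using (0ℓ)
open import Relation.Binary.Bundles using (Setoid)
open import Relation.Binary.Definitions using (Transitive)
import Relation.Binary.Reasoning.Setoid as SetoidReasoning
open import Relation.Binary.Structures using (IsEquivalence)
open import Relation.Nullary using (¬_; Irrelevant)
open import Relation.Nullary.Decidable using (Dec; yes; no; does)
open import Relation.Nullary.Negation using (contradiction)
open import Relation.Nullary.Reflects using (ofʸ; ofⁿ)
open import Relation.Unary using (Decidable)

-- Formal power series

infix 4 _≈_
_≈_ : PS → PS → Set
f ≈ g = ∀ n → f n ≡ g n

≈-isEquivalence : IsEquivalence _≈_
≈-isEquivalence = record
  { refl = λ _ → refl ; sym = λ e n → sym (e n) ; trans = λ e e′ n → trans (e n) (e′ n) }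

PS-setoid : Setoid 0ℓ 0ℓ
PS-setoid = record { isEquivalence = ≈-isEquivalence }

open IsEquivalence ≈-isEquivalence
  using () renaming (refl to ≈-refl; sym to ≈-sym; trans to ≈-trans)

tailPS : PS → PS
tailPS f n = f (suc n)

scale : ℤ → PS → PS
scale c f n = c ℤ.* f n

⊛-suc : ∀ f g n → (f ⊛ g) (suc n) ≡ f 0 ℤ.* g (suc n) ℤ.+ (tailPS f ⊛ g) n
⊛-suc f g n = cong (λ xs → f 0 ℤ.* g (suc n) ℤ.+ sumℤ xs)
  (trans (map-applyUpTo suc (λ i → f i ℤ.* g (suc n ∸ i)) (suc n))
         (sym (map-applyUpTo id (λ i → f (suc i) ℤ.* g (n ∸ i)) (suc n))))

⊛-sucʳ : ∀ f g n → (f ⊛ g) (suc n) ≡ (f ⊛ tailPS g) n ℤ.+ f (suc n) ℤ.* g 0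
⊛-sucʳ f g zero = regroup₀ (f 0) (g 1) (f 1) (g 0)
  where
  regroup₀ : ∀ a b c d → a ℤ.* b ℤ.+ (c ℤ.* d ℤ.+ + 0) ≡ (a ℤ.* b ℤ.+ + 0) ℤ.+ c ℤ.* d
  regroup₀ = solve-∀
⊛-sucʳ f g (suc n) = begin
  (f ⊛ g) (suc (suc n))                                 ≡⟨ ⊛-suc f g (suc n) ⟩
  f 0 ℤ.* g (2 + n) ℤ.+ (tailPS f ⊛ g) (suc n)          ≡⟨ cong (ℤ._+_ (f 0 ℤ.* g (2 + n))) (⊛-sucʳ (tailPS f) g n) ⟩
  f 0 ℤ.* g (2 + n) ℤ.+ ((tailPS f ⊛ tailPS g) n ℤ.+ f (2 + n) ℤ.* g 0)
    ≡⟨ sym (ℤ.+-assoc (f 0 ℤ.* g (2 + n)) _ _) ⟩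
  (f 0 ℤ.* g (2 + n) ℤ.+ (tailPS f ⊛ tailPS g) n) ℤ.+ f (2 + n) ℤ.* g 0
    ≡⟨ cong (ℤ._+ f (2 + n) ℤ.* g 0) (sym (⊛-suc f (tailPS g) n)) ⟩
  (f ⊛ tailPS g) (suc n) ℤ.+ f (2 + n) ℤ.* g 0          ∎
  where open ≡-Reasoning

⊛-comm : ∀ f g → f ⊛ g ≈ g ⊛ f
⊛-comm f g zero    = cong (ℤ._+ + 0) (ℤ.*-comm (f 0) (g 0))
⊛-comm f g (suc n) = begin
  (f ⊛ g) (suc n)                              ≡⟨ ⊛-suc f g n ⟩
  f 0 ℤ.* g (suc n) ℤ.+ (tailPS f ⊛ g) n       ≡⟨ cong (ℤ._+_ (f 0 ℤ.* g (suc n))) (⊛-comm (tailPS f) g n) ⟩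
  f 0 ℤ.* g (suc n) ℤ.+ (g ⊛ tailPS f) n       ≡⟨ ℤ.+-comm (f 0 ℤ.* g (suc n)) _ ⟩
  (g ⊛ tailPS f) n ℤ.+ f 0 ℤ.* g (suc n)       ≡⟨ cong (ℤ._+_ ((g ⊛ tailPS f) n)) (ℤ.*-comm (f 0) (g (suc n))) ⟩
  (g ⊛ tailPS f) n ℤ.+ g (suc n) ℤ.* f 0       ≡⟨ sym (⊛-sucʳ g f n) ⟩
  (g ⊛ f) (suc n)                              ∎
  where open ≡-Reasoning

⊛-congˡ : ∀ {f f′} g → f ≈ f′ → f ⊛ g ≈ f′ ⊛ g
⊛-congˡ g e zero = cong (λ a → a ℤ.* g 0 ℤ.+ + 0) (e 0)
⊛-congˡ {f} {f′} g e (suc n) = begin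
  (f ⊛ g) (suc n)                          ≡⟨ ⊛-suc f g n ⟩
  f 0 ℤ.* g (suc n) ℤ.+ (tailPS f ⊛ g) n   ≡⟨ cong₂ (λ a b → a ℤ.* g (suc n) ℤ.+ b) (e 0) (⊛-congˡ g (e ∘ suc) n) ⟩
  f′ 0 ℤ.* g (suc n) ℤ.+ (tailPS f′ ⊛ g) n ≡⟨ sym (⊛-suc f′ g n) ⟩
  (f′ ⊛ g) (suc n)                         ∎
  where open ≡-Reasoning

⊛-congʳ : ∀ f {g g′} → g ≈ g′ → f ⊛ g ≈ f ⊛ g′
⊛-congʳ f {g} {g′} e = ≈-trans (⊛-comm f g) (≈-trans (⊛-congˡ f e) (⊛-comm g′ f))

⊛-cong : ∀ {f f′ g g′} → f ≈ f′ → g ≈ g′ → f ⊛ g ≈ f′ ⊛ g′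
⊛-cong {f′ = f′} {g} e e′ = ≈-trans (⊛-congˡ g e) (⊛-congʳ f′ e′)

⊕-cong : ∀ {f f′ g g′} → f ≈ f′ → g ≈ g′ → f ⊕ g ≈ f′ ⊕ g′
⊕-cong e e′ n = cong₂ ℤ._+_ (e n) (e′ n)

⊛-distribʳ : ∀ f f′ g → (f ⊕ f′) ⊛ g ≈ (f ⊛ g) ⊕ (f′ ⊛ g)
⊛-distribʳ f f′ g zero = regroup₀ (f 0) (f′ 0) (g 0)
  where
  regroup₀ : ∀ a a′ b → (a ℤ.+ a′) ℤ.* b ℤ.+ + 0 ≡ (a ℤ.* b ℤ.+ + 0) ℤ.+ (a′ ℤ.* b ℤ.+ + 0)
  regroup₀ = solve-∀
⊛-distribʳ f f′ g (suc n) = begin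
  ((f ⊕ f′) ⊛ g) (suc n)
    ≡⟨ ⊛-suc (f ⊕ f′) g n ⟩
  (f 0 ℤ.+ f′ 0) ℤ.* g (suc n) ℤ.+ ((tailPS f ⊕ tailPS f′) ⊛ g) n
    ≡⟨ cong (ℤ._+_ ((f 0 ℤ.+ f′ 0) ℤ.* g (suc n))) (⊛-distribʳ (tailPS f) (tailPS f′) g n) ⟩
  (f 0 ℤ.+ f′ 0) ℤ.* g (suc n) ℤ.+ ((tailPS f ⊛ g) n ℤ.+ (tailPS f′ ⊛ g) n)
    ≡⟨ regroup (f 0) (f′ 0) (g (suc n)) _ _ ⟩
  (f 0 ℤ.* g (suc n) ℤ.+ (tailPS f ⊛ g) n) ℤ.+ (f′ 0 ℤ.* g (suc n) ℤ.+ (tailPS f′ ⊛ g) n)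
    ≡⟨ sym (cong₂ ℤ._+_ (⊛-suc f g n) (⊛-suc f′ g n)) ⟩
  ((f ⊛ g) ⊕ (f′ ⊛ g)) (suc n) ∎
  where
  open ≡-Reasoning
  regroup : ∀ a a′ b x x′ → (a ℤ.+ a′) ℤ.* b ℤ.+ (x ℤ.+ x′) ≡ (a ℤ.* b ℤ.+ x) ℤ.+ (a′ ℤ.* b ℤ.+ x′)
  regroup = solve-∀

⊛-distribˡ : ∀ f g g′ → f ⊛ (g ⊕ g′) ≈ (f ⊛ g) ⊕ (f ⊛ g′)
⊛-distribˡ f g g′ = ≈-trans (⊛-comm f (g ⊕ g′))
  (≈-trans (⊛-distribʳ g g′ f) (⊕-cong (⊛-comm g f) (⊛-comm g′ f)))

⊛-scaleˡ : ∀ c f g → scale c f ⊛ g ≈ scale c (f ⊛ g)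
⊛-scaleˡ c f g zero = regroup₀ c (f 0) (g 0)
  where
  regroup₀ : ∀ c a b → c ℤ.* a ℤ.* b ℤ.+ + 0 ≡ c ℤ.* (a ℤ.* b ℤ.+ + 0)
  regroup₀ = solve-∀
⊛-scaleˡ c f g (suc n) = begin
  (scale c f ⊛ g) (suc n)                                  ≡⟨ ⊛-suc (scale c f) g n ⟩
  c ℤ.* f 0 ℤ.* g (suc n) ℤ.+ (scale c (tailPS f) ⊛ g) n
    ≡⟨ cong (ℤ._+_ (c ℤ.* f 0 ℤ.* g (suc n))) (⊛-scaleˡ c (tailPS f) g n) ⟩
  c ℤ.* f 0 ℤ.* g (suc n) ℤ.+ c ℤ.* (tailPS f ⊛ g) n       ≡⟨ regroup c (f 0) (g (suc n)) _ ⟩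
  c ℤ.* (f 0 ℤ.* g (suc n) ℤ.+ (tailPS f ⊛ g) n)           ≡⟨ cong (c ℤ.*_) (sym (⊛-suc f g n)) ⟩
  c ℤ.* (f ⊛ g) (suc n)                                    ∎
  where
  open ≡-Reasoning
  regroup : ∀ c a b x → c ℤ.* a ℤ.* b ℤ.+ c ℤ.* x ≡ c ℤ.* (a ℤ.* b ℤ.+ x)
  regroup = solve-∀

⊛-assoc : ∀ f g h → (f ⊛ g) ⊛ h ≈ f ⊛ (g ⊛ h)
⊛-assoc f g h zero = regroup₀ (f 0) (g 0) (h 0)
  where
  regroup₀ : ∀ a b c → (a ℤ.* b ℤ.+ + 0) ℤ.* c ℤ.+ + 0 ≡ a ℤ.* (b ℤ.* c ℤ.+ + 0) ℤ.+ + 0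
  regroup₀ = solve-∀
⊛-assoc f g h (suc n) = begin
  ((f ⊛ g) ⊛ h) (suc n)
    ≡⟨ ⊛-suc (f ⊛ g) h n ⟩
  (f 0 ℤ.* g 0 ℤ.+ + 0) ℤ.* h (suc n) ℤ.+ (tailPS (f ⊛ g) ⊛ h) n
    ≡⟨ cong (ℤ._+_ ((f 0 ℤ.* g 0 ℤ.+ + 0) ℤ.* h (suc n))) tail-step ⟩
  (f 0 ℤ.* g 0 ℤ.+ + 0) ℤ.* h (suc n) ℤ.+ (f 0 ℤ.* (tailPS g ⊛ h) n ℤ.+ (tailPS f ⊛ (g ⊛ h)) n)
    ≡⟨ regroup (f 0) (g 0) (h (suc n)) _ _ ⟩
  f 0 ℤ.* (g 0 ℤ.* h (suc n) ℤ.+ (tailPS g ⊛ h) n) ℤ.+ (tailPS f ⊛ (g ⊛ h)) n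
    ≡⟨ cong (λ z → f 0 ℤ.* z ℤ.+ (tailPS f ⊛ (g ⊛ h)) n) (sym (⊛-suc g h n)) ⟩
  f 0 ℤ.* (g ⊛ h) (suc n) ℤ.+ (tailPS f ⊛ (g ⊛ h)) n
    ≡⟨ sym (⊛-suc f (g ⊛ h) n) ⟩
  (f ⊛ (g ⊛ h)) (suc n) ∎
  where
  open ≡-Reasoning
  regroup : ∀ a b c x y → (a ℤ.* b ℤ.+ + 0) ℤ.* c ℤ.+ (a ℤ.* x ℤ.+ y) ≡ a ℤ.* (b ℤ.* c ℤ.+ x) ℤ.+ y
  regroup = solve-∀
  tail-step : (tailPS (f ⊛ g) ⊛ h) n ≡ f 0 ℤ.* (tailPS g ⊛ h) n ℤ.+ (tailPS f ⊛ (g ⊛ h)) n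
  tail-step = trans (⊛-congˡ h (⊛-suc f g) n)
    (trans (⊛-distribʳ (scale (f 0) (tailPS g)) (tailPS f ⊛ g) h n)
      (cong₂ ℤ._+_ (⊛-scaleˡ (f 0) (tailPS g) h n) (⊛-assoc (tailPS f) g h n)))

⊛-identityˡ : ∀ g → onePS ⊛ g ≈ g
⊛-identityˡ g zero    = trans (ℤ.+-identityʳ _) (ℤ.*-identityˡ (g 0))
⊛-identityˡ g (suc n) = begin
  (onePS ⊛ g) (suc n)                        ≡⟨ ⊛-suc onePS g n ⟩
  + 1 ℤ.* g (suc n) ℤ.+ (zeroPS ⊛ g) n        ≡⟨ cong (ℤ._+_ (+ 1 ℤ.* g (suc n))) (⊛-zeroˡ n) ⟩
  + 1 ℤ.* g (suc n) ℤ.+ + 0                   ≡⟨ trans (ℤ.+-identityʳ _) (ℤ.*-identityˡ _) ⟩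
  g (suc n)                                  ∎
  where
  open ≡-Reasoning
  ⊛-zeroˡ : zeroPS ⊛ g ≈ zeroPS
  ⊛-zeroˡ zero    = refl
  ⊛-zeroˡ (suc n) = trans (⊛-suc zeroPS g n) (trans (ℤ.+-identityˡ _) (⊛-zeroˡ n))

⊛-isCommutativeMonoid : IsCommutativeMonoid _≈_ _⊛_ onePS
⊛-isCommutativeMonoid = record
  { isMonoid = record
    { isSemigroup = record
      { isMagma = record { isEquivalence = ≈-isEquivalence ; ∙-cong = ⊛-cong }
      ; assoc = ⊛-assoc }
    ; identity = ⊛-identityˡ , λ g → ≈-trans (⊛-comm g onePS) (⊛-identityˡ g) }
  ; comm = ⊛-comm }

⊛-commutativeMonoid : CommutativeMonoid 0ℓ 0ℓ
⊛-commutativeMonoid = record { isCommutativeMonoid = ⊛-isCommutativeMonoid }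

open CommutativeMonoid ⊛-commutativeMonoid
  using () renaming (identityʳ to ⊛-identityʳ)
open CommutativeSemigroupProperties (CommutativeMonoid.commutativeSemigroup ⊛-commutativeMonoid)
  using (interchange)
open import Algebra.Solver.CommutativeMonoid ⊛-commutativeMonoid using (solve; _⊜_)
  renaming (_⊕_ to _⊛′_)

shift : ℕ → PS → PS
shift zero    g         = g
shift (suc a) g zero    = + 0
shift (suc a) g (suc n) = shift a g n

shift-< : ∀ a g {n} → n < a → shift a g n ≡ + 0
shift-< (suc a) g {zero}  _         = refl
shift-< (suc a) g {suc n} (s≤s n<a) = shift-< a g n<a

shift-+ : ∀ a g n → shift a g (a + n) ≡ g n
shift-+ zero    g n = refl
shift-+ (suc a) g n = shift-+ a g n

mono-zero : mono 0 ≈ onePS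
mono-zero zero    = refl
mono-zero (suc n) = refl

mono-⊛ : ∀ a g → mono a ⊛ g ≈ shift a g
mono-⊛ zero    g = ≈-trans (⊛-congˡ g mono-zero) (⊛-identityˡ g)
mono-⊛ (suc a) g zero    = refl
mono-⊛ (suc a) g (suc n) = begin
  (mono (suc a) ⊛ g) (suc n)                             ≡⟨ ⊛-suc (mono (suc a)) g n ⟩
  + 0 ℤ.* g (suc n) ℤ.+ (tailPS (mono (suc a)) ⊛ g) n   ≡⟨ ℤ.+-identityˡ _ ⟩
  (mono a ⊛ g) n                                         ≡⟨ mono-⊛ a g n ⟩
  shift a g n                                            ∎
  where open ≡-Reasoning

private
  minus-as-scale : ∀ x y → x ℤ.- y ≡ x ℤ.+ ℤ.- + 1 ℤ.* y
  minus-as-scale = solve-∀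

oneMinus⊛ : ∀ a g → oneMinus a ⊛ g ≈ λ n → g n ℤ.- shift a g n
oneMinus⊛ a g n = begin
  (oneMinus a ⊛ g) n
    ≡⟨ ⊛-congˡ g (λ n → minus-as-scale (onePS n) (mono a n)) n ⟩
  ((onePS ⊕ scale (ℤ.- + 1) (mono a)) ⊛ g) n
    ≡⟨ ⊛-distribʳ onePS (scale (ℤ.- + 1) (mono a)) g n ⟩
  (onePS ⊛ g) n ℤ.+ (scale (ℤ.- + 1) (mono a) ⊛ g) n
    ≡⟨ cong₂ ℤ._+_ (⊛-identityˡ g n) (⊛-scaleˡ (ℤ.- + 1) (mono a) g n) ⟩
  g n ℤ.+ ℤ.- + 1 ℤ.* (mono a ⊛ g) n
    ≡⟨ cong (λ z → g n ℤ.+ ℤ.- + 1 ℤ.* z) (mono-⊛ a g n) ⟩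
  g n ℤ.+ ℤ.- + 1 ℤ.* shift a g n
    ≡⟨ sym (minus-as-scale (g n) (shift a g n)) ⟩
  g n ℤ.- shift a g n ∎
  where open ≡-Reasoning

invOneMinus-periodic : ∀ a n → invOneMinus a (a + n) ≡ invOneMinus a n
invOneMinus-periodic a n with a ∣? a + n | a ∣? n
... | yes _     | yes _   = refl
... | no  _     | no  _   = refl
... | yes a∣a+n | no  a∤n = contradiction (∣m+n∣m⇒∣n a∣a+n ∣-refl) a∤n
... | no  a∤a+n | yes a∣n = contradiction (∣m∣n⇒∣m+n ∣-refl a∣n) a∤a+n

invOneMinus-< : ∀ {a n} → n < a → invOneMinus a n ≡ onePS n
invOneMinus-< {a} {zero} _ with a ∣? 0
... | yes _   = refl
... | no  a∤0 = contradiction (a ∣0) a∤0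
invOneMinus-< {a} {suc n} n<a with a ∣? suc n
... | yes a∣n = contradiction (∣⇒≤ a∣n) (ℕ.<⇒≱ n<a)
... | no  _   = refl

oneMinus⊛invOneMinus : ∀ {a} → 1 ≤ a → oneMinus a ⊛ invOneMinus a ≈ onePS
oneMinus⊛invOneMinus {a} 1≤a n = trans (oneMinus⊛ a I n) (telescope n)
  where
  I : PS
  I = invOneMinus a
  telescope : ∀ n → I n ℤ.- shift a I n ≡ onePS n
  telescope n with n ℕ.<? a
  ... | yes n<a = begin
    I n ℤ.- shift a I n   ≡⟨ cong₂ ℤ._-_ (invOneMinus-< n<a) (shift-< a I n<a) ⟩
    onePS n ℤ.- + 0       ≡⟨ ℤ.+-identityʳ (onePS n) ⟩
    onePS n               ∎
    where open ≡-Reasoning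
  ... | no n≮a = begin
    I n ℤ.- shift a I n                           ≡⟨ cong (λ z → I z ℤ.- shift a I z) (sym a+d≡n) ⟩
    I (a + d) ℤ.- shift a I (a + d)               ≡⟨ cong₂ ℤ._-_ (invOneMinus-periodic a d) (shift-+ a I d) ⟩
    I d ℤ.- I d                                   ≡⟨ ℤ.+-inverseʳ (I d) ⟩
    + 0                                           ≡⟨ sym (onePS-pos (ℕ.<-≤-trans 1≤a (ℕ.≮⇒≥ n≮a))) ⟩
    onePS n                                       ∎
    where
    open ≡-Reasoning
    d : ℕ
    d = n ∸ a
    a+d≡n : a + d ≡ n
    a+d≡n = ℕ.m+[n∸m]≡n (ℕ.≮⇒≥ n≮a)
    onePS-pos : ∀ {n} → 0 < n → onePS n ≡ + 0
    onePS-pos {suc n} _ = refl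

prodPS-∷ʳ : ∀ fs f → prodPS (fs ∷ʳ f) ≈ prodPS fs ⊛ f
prodPS-∷ʳ []       f = ⊛-comm f onePS
prodPS-∷ʳ (g ∷ fs) f = ≈-trans (⊛-congʳ g (prodPS-∷ʳ fs f)) (≈-sym (⊛-assoc g (prodPS fs) f))

prodPS-upTo-suc : ∀ (F : ℕ → PS) r → prodPS (map F (upTo (suc r))) ≈ prodPS (map F (upTo r)) ⊛ F r
prodPS-upTo-suc F r n = begin
  prodPS (map F (upTo (suc r))) n         ≡⟨ cong (λ xs → prodPS (map F xs) n) (sym (upTo-∷ʳ r)) ⟩
  prodPS (map F (upTo r ∷ʳ r)) n          ≡⟨ cong (λ xs → prodPS xs n) (map-++ F (upTo r) [ r ]) ⟩
  prodPS (map F (upTo r) ∷ʳ F r) n        ≡⟨ prodPS-∷ʳ (map F (upTo r)) (F r) n ⟩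
  (prodPS (map F (upTo r)) ⊛ F r) n       ∎
  where open ≡-Reasoning

prodPS-⊛ : ∀ (F G : ℕ → PS) xs → prodPS (map F xs) ⊛ prodPS (map G xs) ≈ prodPS (map (λ t → F t ⊛ G t) xs)
prodPS-⊛ F G []       = ⊛-identityˡ onePS
prodPS-⊛ F G (x ∷ xs) = ≈-trans (interchange (F x) _ (G x) _) (⊛-congʳ (F x ⊛ G x) (prodPS-⊛ F G xs))

prodPS-ones : ∀ (F : ℕ → PS) xs → (∀ t → F t ≈ onePS) → prodPS (map F xs) ≈ onePS
prodPS-ones F []       _     = ≈-refl
prodPS-ones F (x ∷ xs) F≈1 = ≈-trans (⊛-cong (F≈1 x) (prodPS-ones F xs F≈1)) (⊛-identityˡ onePS)

poch⊛invPoch : ∀ c d r → 1 ≤ c → poch c d r ⊛ invPoch c d r ≈ onePS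
poch⊛invPoch c d r 1≤c = ≈-trans
  (prodPS-⊛ (λ t → oneMinus (c + d * t)) (λ t → invOneMinus (c + d * t)) (upTo r))
  (prodPS-ones _ (upTo r) (λ t → oneMinus⊛invOneMinus (ℕ.≤-trans 1≤c (ℕ.m≤m+n c (d * t)))))

poch-suc : ∀ c d r → poch c d (suc r) ≈ poch c d r ⊛ oneMinus (c + d * r)
poch-suc c d = prodPS-upTo-suc (λ t → oneMinus (c + d * t))

invPoch-suc : ∀ c d r → invPoch c d (suc r) ≈ invPoch c d r ⊛ invOneMinus (c + d * r)
invPoch-suc c d = prodPS-upTo-suc (λ t → invOneMinus (c + d * t))

invPoch-∷ : ∀ c d r → invPoch c d (suc r) ≈ invOneMinus c ⊛ invPoch (c + d) d r
invPoch-∷ c d r n = cong₂ (λ f fs → (f ⊛ prodPS fs) n)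
  (cong invOneMinus (trans (cong (_+_ c) (ℕ.*-zeroʳ d)) (ℕ.+-identityʳ c)))
  (begin
    map F (applyUpTo suc r)      ≡⟨ cong (map F) (sym (map-upTo suc r)) ⟩
    map F (map suc (upTo r))     ≡⟨ sym (map-∘ (upTo r)) ⟩
    map (F ∘ suc) (upTo r)       ≡⟨ map-cong (λ t → cong invOneMinus (c+d*[1+t] t)) (upTo r) ⟩
    map F′ (upTo r)              ∎)
  where
  open ≡-Reasoning
  F F′ : ℕ → PS
  F  t = invOneMinus (c + d * t)
  F′ t = invOneMinus (c + d + d * t)
  c+d*[1+t] : ∀ t → c + d * suc t ≡ c + d + d * t
  c+d*[1+t] t = trans (cong (_+_ c) (ℕ.*-suc d t)) (sym (ℕ.+-assoc c d (d * t)))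

-- Gaussian binomials

shift-oneMinus : ∀ a c n → shift a (oneMinus c) n ≡ mono a n ℤ.- mono (a + c) n
shift-oneMinus zero    c n       = cong (ℤ._- mono c n) (sym (mono-zero n))
shift-oneMinus (suc a) c zero    = refl
shift-oneMinus (suc a) c (suc n) = shift-oneMinus a c n

oneMinus-+ : ∀ a c → oneMinus a ⊕ (mono a ⊛ oneMinus c) ≈ oneMinus (a + c)
oneMinus-+ a c n = begin
  oneMinus a n ℤ.+ (mono a ⊛ oneMinus c) n                        ≡⟨ cong (ℤ._+_ (oneMinus a n)) (mono-⊛ a (oneMinus c) n) ⟩
  oneMinus a n ℤ.+ shift a (oneMinus c) n                         ≡⟨ cong (ℤ._+_ (oneMinus a n)) (shift-oneMinus a c n) ⟩
  (onePS n ℤ.- mono a n) ℤ.+ (mono a n ℤ.- mono (a + c) n)        ≡⟨ telescope (onePS n) (mono a n) (mono (a + c) n) ⟩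
  oneMinus (a + c) n                                              ∎
  where
  open ≡-Reasoning
  telescope : ∀ x y z → (x ℤ.- y) ℤ.+ (y ℤ.- z) ≡ x ℤ.- z
  telescope = solve-∀

boxGF : ℕ → ℕ → PS
boxGF zero    w       = onePS
boxGF (suc b) zero    = onePS
boxGF (suc b) (suc w) = boxGF (suc b) w ⊕ (mono (2 + 2 * w) ⊛ boxGF b (suc w))

boxGF⊛poch-suc : ∀ b w →
  boxGF (suc b) w ⊛ (poch 2 2 (suc b) ⊛ poch 2 2 w) ≈ poch 2 2 (suc b + w) →
  boxGF b (suc w) ⊛ (poch 2 2 b ⊛ poch 2 2 (suc w)) ≈ poch 2 2 (b + suc w) →
  boxGF (suc b) (suc w) ⊛ (poch 2 2 (suc b) ⊛ poch 2 2 (suc w)) ≈ poch 2 2 (suc b + suc w)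
boxGF⊛poch-suc b w left right = begin
  (A ⊕ (qʷ ⊛ B)) ⊛ (P (suc b) ⊛ P (suc w))                     ≈⟨ ⊛-distribʳ A (qʷ ⊛ B) _ ⟩
  (A ⊛ (P (suc b) ⊛ P (suc w))) ⊕ ((qʷ ⊛ B) ⊛ (P (suc b) ⊛ P (suc w)))
    ≈⟨ ⊕-cong first second ⟩
  (X ⊛ ω₁) ⊕ (X ⊛ (qʷ ⊛ ω₂))                                   ≈⟨ ≈-sym (⊛-distribˡ X ω₁ (qʷ ⊛ ω₂)) ⟩
  X ⊛ (ω₁ ⊕ (qʷ ⊛ ω₂))                                         ≈⟨ ⊛-congʳ X (oneMinus-+ (2 + 2 * w) (2 + 2 * b)) ⟩
  X ⊛ oneMinus (2 + 2 * w + (2 + 2 * b))                       ≈⟨ (λ n → cong (λ z → (X ⊛ oneMinus z) n) (exponents b w)) ⟩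
  X ⊛ oneMinus (2 + 2 * (suc b + w))                           ≈⟨ ≈-sym (poch-suc 2 2 (suc b + w)) ⟩
  P (suc (suc b + w))                                          ≈⟨ (λ n → cong (λ z → P z n) (sym (ℕ.+-suc (suc b) w))) ⟩
  P (suc b + suc w)                                            ∎
  where
  open SetoidReasoning PS-setoid
  P : ℕ → PS
  P = poch 2 2
  A B qʷ ω₁ ω₂ X : PS
  A = boxGF (suc b) w
  B = boxGF b (suc w)
  qʷ = mono (2 + 2 * w)
  ω₁ = oneMinus (2 + 2 * w)
  ω₂ = oneMinus (2 + 2 * b)
  X = P (suc b + w)
  exponents : ∀ b w → 2 + 2 * w + (2 + 2 * b) ≡ 2 + 2 * (suc b + w)
  exponents = ℕ-solve-∀
  first : A ⊛ (P (suc b) ⊛ P (suc w)) ≈ X ⊛ ω₁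
  first = begin
    A ⊛ (P (suc b) ⊛ P (suc w))    ≈⟨ ⊛-congʳ A (⊛-congʳ (P (suc b)) (poch-suc 2 2 w)) ⟩
    A ⊛ (P (suc b) ⊛ (P w ⊛ ω₁))
      ≈⟨ solve 4 (λ a p p′ o → a ⊛′ (p ⊛′ (p′ ⊛′ o)) ⊜ (a ⊛′ (p ⊛′ p′)) ⊛′ o) ≈-refl A (P (suc b)) (P w) ω₁ ⟩
    (A ⊛ (P (suc b) ⊛ P w)) ⊛ ω₁   ≈⟨ ⊛-congˡ ω₁ left ⟩
    X ⊛ ω₁                         ∎
  second : (qʷ ⊛ B) ⊛ (P (suc b) ⊛ P (suc w)) ≈ X ⊛ (qʷ ⊛ ω₂)
  second = begin
    (qʷ ⊛ B) ⊛ (P (suc b) ⊛ P (suc w))    ≈⟨ ⊛-congʳ (qʷ ⊛ B) (⊛-congˡ (P (suc w)) (poch-suc 2 2 b)) ⟩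
    (qʷ ⊛ B) ⊛ ((P b ⊛ ω₂) ⊛ P (suc w))
      ≈⟨ solve 5 (λ q c p o p′ → (q ⊛′ c) ⊛′ ((p ⊛′ o) ⊛′ p′) ⊜ (c ⊛′ (p ⊛′ p′)) ⊛′ (q ⊛′ o)) ≈-refl
           qʷ B (P b) ω₂ (P (suc w)) ⟩
    (B ⊛ (P b ⊛ P (suc w))) ⊛ (qʷ ⊛ ω₂)  ≈⟨ ⊛-congˡ (qʷ ⊛ ω₂) right ⟩
    P (b + suc w) ⊛ (qʷ ⊛ ω₂)            ≈⟨ (λ n → cong (λ z → (P z ⊛ (qʷ ⊛ ω₂)) n) (ℕ.+-suc b w)) ⟩
    X ⊛ (qʷ ⊛ ω₂)                        ∎

boxGF⊛poch : ∀ b w → boxGF b w ⊛ (poch 2 2 b ⊛ poch 2 2 w) ≈ poch 2 2 (b + w)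
boxGF⊛poch zero    w       = ≈-trans (⊛-identityˡ _) (⊛-identityˡ _)
boxGF⊛poch (suc b) zero    = ≈-trans (≈-trans (⊛-identityˡ _) (⊛-identityʳ _))
  (λ n → cong (λ z → poch 2 2 z n) (sym (ℕ.+-identityʳ (suc b))))
boxGF⊛poch (suc b) (suc w) = boxGF⊛poch-suc b w (boxGF⊛poch (suc b) w) (boxGF⊛poch b (suc w))

gauss2≈boxGF : ∀ b w → gauss2 (b + w) b ≈ boxGF b w
gauss2≈boxGF b w = begin
  P (b + w) ⊛ (P⁻¹ b ⊛ P⁻¹ (b + w ∸ b))
    ≈⟨ (λ n → cong (λ z → (P (b + w) ⊛ (P⁻¹ b ⊛ P⁻¹ z)) n) (ℕ.m+n∸m≡n b w)) ⟩
  P (b + w) ⊛ (P⁻¹ b ⊛ P⁻¹ w)                         ≈⟨ ⊛-congˡ (P⁻¹ b ⊛ P⁻¹ w) (≈-sym (boxGF⊛poch b w)) ⟩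
  (boxGF b w ⊛ (P b ⊛ P w)) ⊛ (P⁻¹ b ⊛ P⁻¹ w)
    ≈⟨ solve 5 (λ g p p′ i i′ → (g ⊛′ (p ⊛′ p′)) ⊛′ (i ⊛′ i′) ⊜ g ⊛′ ((p ⊛′ i) ⊛′ (p′ ⊛′ i′))) ≈-refl
         (boxGF b w) (P b) (P w) (P⁻¹ b) (P⁻¹ w) ⟩
  boxGF b w ⊛ ((P b ⊛ P⁻¹ b) ⊛ (P w ⊛ P⁻¹ w))
    ≈⟨ ⊛-congʳ (boxGF b w) (⊛-cong (poch⊛invPoch 2 2 b (s≤s z≤n)) (poch⊛invPoch 2 2 w (s≤s z≤n))) ⟩
  boxGF b w ⊛ (onePS ⊛ onePS)                         ≈⟨ ⊛-congʳ (boxGF b w) (⊛-identityˡ onePS) ⟩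
  boxGF b w ⊛ onePS                                   ≈⟨ ⊛-identityʳ (boxGF b w) ⟩
  boxGF b w                                           ∎
  where
  open SetoidReasoning PS-setoid
  P P⁻¹ : ℕ → PS
  P = poch 2 2
  P⁻¹ = invPoch 2 2

-- Counting, and weighted sets with a generating function

Counted : Set → ℤ → Set
Counted X z = Σ ℕ λ N → (+ N ≡ z) × (Fin N ↔ X)

Counted-↔ : ∀ {X Y z} → X ↔ Y → Counted X z → Counted Y z
Counted-↔ X↔Y (N , N≡z , Fin↔X) = N , N≡z , ↔-trans Fin↔X X↔Y

Counted-≡ : ∀ {X z z′} → z ≡ z′ → Counted X z → Counted X z′
Counted-≡ z≡z′ (N , N≡z , Fin↔X) = N , trans N≡z z≡z′ , Fin↔X

Counted-empty : ∀ {X} → ¬ X → Counted X (+ 0)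
Counted-empty ¬x = 0 , refl , mk↔ₛ′ (λ ()) (λ x → contradiction x ¬x) (λ x → contradiction x ¬x) (λ ())

Counted-singleton : ∀ {X} (x : X) → Irrelevant X → Counted X (+ 1)
Counted-singleton x unique =
  1 , refl , mk↔ₛ′ (λ _ → x) (λ _ → Fin.zero) (unique x) (λ { Fin.zero → refl ; (Fin.suc ()) })

Counted-if : ∀ {P X : Set} (P? : Dec P) → (P → Counted X (+ 1)) → (¬ P → Counted X (+ 0)) →
             Counted X (if does P? then + 1 else + 0)
Counted-if (yes p)  one _    = one p
Counted-if (no  ¬p) _   none = none ¬p

Counted-×-if : ∀ {P Y : Set} {z} (P? : Dec P) → Irrelevant P → (P → Counted Y z) →
               Counted (P × Y) (if does P? then z else + 0)
Counted-×-if (yes p)  P-irrelevant count =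
  Counted-↔ (mk↔ₛ′ (p ,_) proj₂ (λ (p′ , y) → cong (_, y) (P-irrelevant p p′)) (λ _ → refl)) (count p)
Counted-×-if (no  ¬p) _            _     = Counted-empty (¬p ∘ proj₁)

Counted-⊎ : ∀ {X Y a b} → Counted X a → Counted Y b → Counted (X ⊎ Y) (a ℤ.+ b)
Counted-⊎ (N , N≡a , φ) (M , M≡b , ψ) =
  N + M , trans (ℤ.pos-+ N M) (cong₂ ℤ._+_ N≡a M≡b) , ↔-trans Fin.+↔⊎ (φ ⊎-↔ ψ)

Counted-× : ∀ {X Y a b} → Counted X a → Counted Y b → Counted (X × Y) (a ℤ.* b)
Counted-× (N , N≡a , φ) (M , M≡b , ψ) =
  N * M , trans (ℤ.pos-* N M) (cong₂ ℤ._*_ N≡a M≡b) , ↔-trans Fin.*↔× (φ ×-↔ ψ)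

Counted-Σ< : ∀ {Q : ℕ → Set} {z : ℕ → ℤ} n → (∀ i → i < n → Counted (Q i) (z i)) →
             Counted (Σ ℕ λ i → i < n × Q i) (sumℤ (map z (upTo n)))
Counted-Σ< zero _ = Counted-empty λ { (_ , () , _) }
Counted-Σ< {Q} {z} (suc n) count =
  Counted-≡ (cong (λ xs → z 0 ℤ.+ sumℤ xs) (trans (map-upTo (z ∘ suc) n) (sym (map-applyUpTo suc z n))))
  (Counted-↔ split (Counted-⊎ (count 0 (s≤s z≤n)) (Counted-Σ< n (λ i i<n → count (suc i) (s≤s i<n)))))
  where
  split : (Q 0 ⊎ Σ ℕ λ i → i < n × Q (suc i)) ↔ (Σ ℕ λ i → i < suc n × Q i)
  split = mk↔ₛ′ (λ { (inj₁ q) → 0 , s≤s z≤n , q ; (inj₂ (i , i<n , q)) → suc i , s≤s i<n , q })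
                (λ { (zero , _ , q) → inj₁ q ; (suc i , s≤s i<n , q) → inj₂ (i , i<n , q) })
                (λ { (zero , s≤s z≤n , q) → refl ; (suc i , s≤s i<n , q) → refl })
                (λ { (inj₁ q) → refl ; (inj₂ _) → refl })

sumPS-map : ∀ (F : ℕ → PS) xs n → sumPS (map F xs) n ≡ sumℤ (map (λ x → F x n) xs)
sumPS-map F []       n = refl
sumPS-map F (x ∷ xs) n = cong (ℤ._+_ (F x n)) (sumPS-map F xs n)

sumℤ-map-filter : ∀ {P : ℕ → Set} (P? : Decidable P) (f : ℕ → ℤ) xs →
                  sumℤ (map f (filter P? xs)) ≡ sumℤ (map (λ x → if does (P? x) then f x else + 0) xs)
sumℤ-map-filter P? f []       = refl
sumℤ-map-filter P? f (x ∷ xs) with P? x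
... | yes _ = cong (ℤ._+_ (f x)) (sumℤ-map-filter P? f xs)
... | no  _ = trans (sumℤ-map-filter P? f xs) (sym (ℤ.+-identityˡ _))

record Weighted : Set₁ where
  constructor weighted
  field
    Carrier : Set
    weight  : Carrier → ℕ
open Weighted

OfWeight : Weighted → ℕ → Set
OfWeight C n = Σ (Carrier C) λ x → weight C x ≡ n

HasGF : Weighted → PS → Set
HasGF C f = ∀ n → Counted (OfWeight C n) (f n)

HasGF-≈ : ∀ {C f g} → f ≈ g → HasGF C f → HasGF C g
HasGF-≈ f≈g gf n = Counted-≡ (f≈g n) (gf n)

×-irrelevant : ∀ {A B : Set} → Irrelevant A → Irrelevant B → Irrelevant (A × B)
×-irrelevant irrA irrB (a , b) (a′ , b′) = cong₂ _,_ (irrA a a′) (irrB b b′)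

Σ-≡ : ∀ {A : Set} {P : A → Set} → (∀ {x} → Irrelevant (P x)) →
      ∀ {x y} {px : P x} {py : P y} → x ≡ y → (x , px) ≡ (y , py)
Σ-≡ irr {px = px} {py} refl = cong (_ ,_) (irr px py)

infix 4 _≅_
record _≅_ (C D : Weighted) : Set where
  field
    bijection : Carrier C ↔ Carrier D
    weight-to : ∀ x → weight D (Inverse.to bijection x) ≡ weight C x

OfWeight-≅ : ∀ {C D} → C ≅ D → ∀ n → OfWeight C n ↔ OfWeight D n
OfWeight-≅ {C} {D} C≅D n = mk↔ₛ′
  (λ { (x , wx≡n) → to x , trans (weight-to x) wx≡n })
  (λ { (y , wy≡n) → from y , trans (sym (weight-to (from y))) (trans (cong (weight D) (strictlyInverseˡ y)) wy≡n) })
  (λ { (y , _) → Σ-≡ ℕ.≡-irrelevant (strictlyInverseˡ y) })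
  (λ { (x , _) → Σ-≡ ℕ.≡-irrelevant (strictlyInverseʳ x) })
  where
  open _≅_ C≅D
  open Inverse bijection

HasGF-≅ : ∀ {C D f} → C ≅ D → HasGF C f → HasGF D f
HasGF-≅ C≅D gf n = Counted-↔ (OfWeight-≅ C≅D n) (gf n)

≅-bijective : ∀ {C D} (f : Carrier C → Carrier D) → Injective _≡_ _≡_ f → StrictlySurjective _≡_ f →
              (∀ x → weight D (f x) ≡ weight C x) → C ≅ D
≅-bijective f f-inj f-surj f-weight = record
  { bijection = ⤖⇒↔ (mk⤖ (f-inj , strictlySurjective⇒surjective f-surj)) ; weight-to = f-weight }

point : ℕ → Weighted
point e = weighted ⊤ (λ _ → e)

HasGF-point : ∀ e → HasGF (point e) (mono e)
HasGF-point e n = Counted-if (e ℕ.≟ n)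
  (λ { refl → Counted-singleton (tt , refl) (λ _ _ → Σ-≡ ℕ.≡-irrelevant refl) })
  (λ e≢n → Counted-empty (λ { (tt , e≡n) → e≢n e≡n }))

HasGF-unit : ∀ {C} (x : Carrier C) → (∀ y → x ≡ y) → weight C x ≡ 0 → HasGF C onePS
HasGF-unit {C} x unique wx≡0 = HasGF-≅ point≅ (HasGF-≈ mono-zero (HasGF-point 0))
  where
  point≅ : point 0 ≅ C
  point≅ = record { bijection = mk↔ₛ′ (λ _ → x) (λ _ → tt) unique (λ _ → refl) ; weight-to = λ _ → wx≡0 }

_⊎ʷ_ : Weighted → Weighted → Weighted
C ⊎ʷ D = weighted (Carrier C ⊎ Carrier D) [ weight C , weight D ]′

HasGF-⊎ : ∀ {C D f g} → HasGF C f → HasGF D g → HasGF (C ⊎ʷ D) (f ⊕ g)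
HasGF-⊎ gf gg n = Counted-↔ split (Counted-⊎ (gf n) (gg n))
  where
  split = mk↔ₛ′ (λ { (inj₁ (x , e)) → inj₁ x , e ; (inj₂ (y , e)) → inj₂ y , e })
                (λ { (inj₁ x , e) → inj₁ (x , e) ; (inj₂ y , e) → inj₂ (y , e) })
                (λ { (inj₁ x , e) → refl ; (inj₂ y , e) → refl })
                (λ { (inj₁ _) → refl ; (inj₂ _) → refl })

_×ʷ_ : Weighted → Weighted → Weighted
C ×ʷ D = weighted (Carrier C × Carrier D) λ (x , y) → weight C x + weight D y

OfWeight-×ʷ : ∀ C D n → (Σ ℕ λ i → i < suc n × (OfWeight C i × OfWeight D (n ∸ i))) ↔ OfWeight (C ×ʷ D) n
OfWeight-×ʷ C D n = mk↔ₛ′ join split join∘split split∘join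
  where
  join : (Σ ℕ λ i → i < suc n × (OfWeight C i × OfWeight D (n ∸ i))) → OfWeight (C ×ʷ D) n
  join (i , s≤s i≤n , (x , refl) , (y , wy≡n∸i)) = (x , y) , trans (cong (_+_ (weight C x)) wy≡n∸i) (ℕ.m+[n∸m]≡n i≤n)
  split : OfWeight (C ×ʷ D) n → Σ ℕ λ i → i < suc n × (OfWeight C i × OfWeight D (n ∸ i))
  split ((x , y) , e) = weight C x , s≤s (subst (weight C x ≤_) e (ℕ.m≤m+n _ _)) , (x , refl) ,
    (y , trans (sym (ℕ.m+n∸m≡n (weight C x) (weight D y))) (cong (_∸ weight C x) e))
  join∘split : ∀ z → join (split z) ≡ z
  join∘split _ = Σ-≡ ℕ.≡-irrelevant refl
  split∘join : ∀ z → split (join z) ≡ z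
  split∘join (i , s≤s _ , (x , refl) , (y , _)) =
    cong₂ (λ p q → i , s≤s p , (x , refl) , (y , q)) (ℕ.≤-irrelevant _ _) (ℕ.≡-irrelevant _ _)

HasGF-× : ∀ {C D f g} → HasGF C f → HasGF D g → HasGF (C ×ʷ D) (f ⊛ g)
HasGF-× {C} {D} gf gg n =
  Counted-↔ (OfWeight-×ʷ C D n) (Counted-Σ< (suc n) (λ i _ → Counted-× (gf i) (gg (n ∸ i))))

multiples : ℕ → Weighted
multiples a = weighted ℕ (_* a)

HasGF-multiples : ∀ {a} → 1 ≤ a → HasGF (multiples a) (invOneMinus a)
HasGF-multiples {suc a} _ n = Counted-if (suc a ∣? n)
  (λ { (divides j n≡j*a) → Counted-singleton (j , sym n≡j*a)
         (λ { (i , p) (i′ , p′) → Σ-≡ ℕ.≡-irrelevant (ℕ.*-cancelʳ-≡ i i′ (suc a) (trans p (sym p′))) }) })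
  (λ a∤n → Counted-empty λ { (j , j*a≡n) → a∤n (divides j (sym j*a≡n)) })

-- Decreasing lists and odd numbers

Decreasing : List ℕ → Set
Decreasing = Linked _≥_

Decreasing-irrelevant : ∀ {xs} → Irrelevant (Decreasing xs)
Decreasing-irrelevant = Linked.irrelevant ℕ.≤-irrelevant

private
  ≥-trans : Transitive _≥_
  ≥-trans i≥j j≥k = ℕ.≤-trans j≥k i≥j

  Decreasing⇒AllPairs : ∀ {xs} → Decreasing xs → AllPairs _≥_ xs
  Decreasing⇒AllPairs = Linkedₚ.Linked⇒AllPairs ≥-trans

Decreasing-head : ∀ {x xs} → Decreasing (x ∷ xs) → All (_≤ x) xs
Decreasing-head d = AllPairs.head (Decreasing⇒AllPairs d)

Decreasing-∷ : ∀ {x xs} → All (_≤ x) xs → Decreasing xs → Decreasing (x ∷ xs)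
Decreasing-∷ xs≤x d = Linkedₚ.AllPairs⇒Linked (xs≤x ∷ Decreasing⇒AllPairs d)

Decreasing-++ : ∀ {xs ys} → Decreasing xs → Decreasing ys → All (λ x → All (_≤ x) ys) xs →
                Decreasing (xs ++ ys)
Decreasing-++ dxs dys ys≤xs = Linkedₚ.AllPairs⇒Linked
  (AllPairsₚ.++⁺ (Decreasing⇒AllPairs dxs) (Decreasing⇒AllPairs dys) ys≤xs)

Decreasing-++⁻ : ∀ xs {ys} → Decreasing (xs ++ ys) → Decreasing xs × Decreasing ys
Decreasing-++⁻ []       d = [] , d
Decreasing-++⁻ (x ∷ xs) {ys} d = Decreasing-∷ (Allₚ.++⁻ˡ xs (Decreasing-head d)) (proj₁ ih) , proj₂ ih
  where
  ih : Decreasing xs × Decreasing ys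
  ih = Decreasing-++⁻ xs (Linked.tail d)

Decreasing-++-∷ : ∀ xs {y ys} → Decreasing (xs ++ y ∷ ys) → All (y ≤_) xs
Decreasing-++-∷ []       _ = []
Decreasing-++-∷ (x ∷ xs) d = All.head (Allₚ.++⁻ʳ xs (Decreasing-head d)) ∷ Decreasing-++-∷ xs (Linked.tail d)

Decreasing-map : ∀ {f : ℕ → ℕ} → (∀ {a b} → b ≤ a → f b ≤ f a) → ∀ {xs} → Decreasing xs → Decreasing (map f xs)
Decreasing-map f-mono d = Linkedₚ.map⁺ (Linked.map f-mono d)

Odd : ℕ → Set
Odd a = a % 2 ≡ 1

nthOdd : ℕ → ℕ
nthOdd q = 1 + q * 2

nthOdd-odd : ∀ q → Odd (nthOdd q)
nthOdd-odd q = [m+kn]%n≡m%n 1 q 2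

odd⇒nthOdd : ∀ {y} → Odd y → y ≡ nthOdd (y / 2)
odd⇒nthOdd {y} y%2≡1 = trans (m≡m%n+[m/n]*n y 2) (cong (_+ (y / 2) * 2) y%2≡1)

nthOdd-mono-≤ : ∀ {a b} → a ≤ b → nthOdd a ≤ nthOdd b
nthOdd-mono-≤ a≤b = s≤s (ℕ.*-monoˡ-≤ 2 a≤b)

nthOdd-cancel-≤ : ∀ {a b} → nthOdd a ≤ nthOdd b → a ≤ b
nthOdd-cancel-≤ {a} {b} (s≤s 2a≤2b) = ℕ.*-cancelʳ-≤ a b 2 2a≤2b

nthOdd-cancel-< : ∀ {a b} → nthOdd a < nthOdd b → a < b
nthOdd-cancel-< p = ℕ.≰⇒> (λ b≤a → ℕ.<⇒≱ p (nthOdd-mono-≤ b≤a))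

nthOdd-injective : ∀ {a b} → nthOdd a ≡ nthOdd b → a ≡ b
nthOdd-injective {a} {b} p = ℕ.*-cancelʳ-≡ a b 2 (ℕ.suc-injective p)

nthOdd-half : ∀ q → nthOdd q / 2 ≡ q
nthOdd-half q = nthOdd-injective (sym (odd⇒nthOdd (nthOdd-odd q)))

oddIndex : ℕ → ℕ → ℕ
oddIndex c t = t / 2 ∸ c

oddIndex-nthOdd : ∀ c μ → oddIndex c (nthOdd (c + μ)) ≡ μ
oddIndex-nthOdd c μ = trans (cong (_∸ c) (nthOdd-half (c + μ))) (ℕ.m+n∸m≡n c μ)

nthOdd-oddIndex : ∀ c {t} → Odd t → nthOdd c ≤ t → nthOdd (c + oddIndex c t) ≡ t
nthOdd-oddIndex c {t} t-odd c≤t = trans (cong nthOdd (ℕ.m+[n∸m]≡n {c} {t / 2} c≤t/2)) (sym (odd⇒nthOdd t-odd))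
  where
  c≤t/2 : c ≤ t / 2
  c≤t/2 = nthOdd-cancel-≤ (subst (nthOdd c ≤_) (odd⇒nthOdd t-odd) c≤t)

oddIndex-mono-≤ : ∀ c {a b} → a ≤ b → oddIndex c a ≤ oddIndex c b
oddIndex-mono-≤ c a≤b = ℕ.∸-monoˡ-≤ c (/-monoˡ-≤ 2 a≤b)

map-nthOdd-oddIndex : ∀ c {ts} → All Odd ts → All (nthOdd c ≤_) ts → map (λ μ → nthOdd (c + μ)) (map (oddIndex c) ts) ≡ ts
map-nthOdd-oddIndex c []                 []           = refl
map-nthOdd-oddIndex c (t-odd ∷ ts-odd) (c≤t ∷ c≤ts) = cong₂ _∷_ (nthOdd-oddIndex c t-odd c≤t) (map-nthOdd-oddIndex c ts-odd c≤ts)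

nthOdd-+-cancelˡ : ∀ c {a b} → nthOdd (c + a) ≡ nthOdd (c + b) → a ≡ b
nthOdd-+-cancelˡ c e = ℕ.+-cancelˡ-≡ c _ _ (nthOdd-injective e)

odd-<-nthOdd-suc : ∀ {R b} → Odd b → b < nthOdd (suc R) → b ≤ nthOdd R
odd-<-nthOdd-suc {R} {b} b-odd b<next = subst (_≤ nthOdd R) (sym (odd⇒nthOdd b-odd))
  (nthOdd-mono-≤ (ℕ.≤-pred (nthOdd-cancel-< {b / 2} {suc R} (subst (_< nthOdd (suc R)) (odd⇒nthOdd b-odd) b<next))))

sum-nthOdd : ∀ c μs → sum (map (λ μ → nthOdd (c + μ)) μs) ≡ length μs * nthOdd c + 2 * sum μs
sum-nthOdd c []       = refl
sum-nthOdd c (μ ∷ μs) = trans (cong (_+_ (nthOdd (c + μ))) (sum-nthOdd c μs)) (regroup c μ (length μs) (sum μs))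
  where
  regroup : ∀ c μ n s → (1 + (c + μ) * 2) + (n * (1 + c * 2) + 2 * s) ≡ (1 + n) * (1 + c * 2) + 2 * (μ + s)
  regroup = ℕ-solve-∀

row-++-∷ : ∀ xs y ys → row (xs ++ y ∷ ys) (suc (length xs)) ≡ y
row-++-∷ []       y ys = refl
row-++-∷ (x ∷ xs) y ys = row-++-∷ xs y ys

take-row : ∀ r ps → 1 ≤ row ps (suc r) → ps ≡ take r ps ++ row ps (suc r) ∷ drop (suc r) ps
take-row r       []       ()
take-row zero    (x ∷ xs) _ = refl
take-row (suc r) (x ∷ xs) p = cong (x ∷_) (take-row r xs p)

length-take-row : ∀ r ps → 1 ≤ row ps (suc r) → length (take r ps) ≡ r
length-take-row r       []       ()
length-take-row zero    (x ∷ xs) _ = refl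
length-take-row (suc r) (x ∷ xs) p = cong suc (length-take-row r xs p)

length-map-≡ : ∀ {f g : ℕ → ℕ} {n} xs ys → length xs ≡ n → length ys ≡ n → length (map f xs) ≡ length (map g ys)
length-map-≡ {f} {g} xs ys lx ly = trans (length-map f xs) (trans lx (sym (trans (length-map g ys) ly)))

++-injective : ∀ {A : Set} (xs xs′ : List A) {ys ys′} → length xs ≡ length xs′ →
               xs ++ ys ≡ xs′ ++ ys′ → xs ≡ xs′ × ys ≡ ys′
++-injective []       []         _ eq = refl , eq
++-injective (x ∷ xs) (x′ ∷ xs′) l eq =
  let (xs≡ , ys≡) = ++-injective xs xs′ (ℕ.suc-injective l) (∷-injectiveʳ eq) in cong₂ _∷_ (∷-injectiveˡ eq) xs≡ , ys≡

dropWhile-≤ : ∀ c {xs} → Decreasing xs → All (_< c) (dropWhile (c ℕ.≤?_) xs)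
dropWhile-≤ c {[]}     _ = []
dropWhile-≤ c {x ∷ xs} d with c ℕ.≤ᵇ x | ℕ.≤ᵇ-reflects-≤ c x
... | true  | ofʸ _   = dropWhile-≤ c (Linked.tail d)
... | false | ofⁿ c≰x = x<c ∷ All.map (λ y≤x → ℕ.≤-<-trans y≤x x<c) (Decreasing-head d)
  where
  x<c : x < c
  x<c = ℕ.≰⇒> c≰x

-- Three families of decreasing lists

head₀ : List ℕ → ℕ
head₀ []      = 0
head₀ (x ∷ _) = x

headWeighted : ℕ → List ℕ → ℕ
headWeighted c []       = 0
headWeighted c (μ ∷ μs) = c * μ + 2 * sum μs

DecTuple : ℕ → List ℕ → Set
DecTuple r μs = length μs ≡ r × Decreasing μs

DecTuple-irrelevant : ∀ {r μs} → Irrelevant (DecTuple r μs)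
DecTuple-irrelevant = ×-irrelevant ℕ.≡-irrelevant Decreasing-irrelevant

-- Weighting the head by c rather than 2 is what makes the family recursive: writing the head as
-- μ₁ = j + μ₂ leaves c · j plus the tuple μ₂ , μ₃ , … with its head now weighted c + 2.
DecTuples : ℕ → ℕ → Weighted
DecTuples c r = weighted (Σ (List ℕ) (DecTuple r)) (headWeighted c ∘ proj₁)

DecTuples-∷ : ∀ c r → multiples c ×ʷ DecTuples (c + 2) r ≅ DecTuples c (suc r)
DecTuples-∷ c r = ≅-bijective push push-injective push-surjective push-weight
  where
  head₀-≥ : ∀ {μs} → Decreasing μs → All (_≤ head₀ μs) μs
  head₀-≥ {[]}    _ = []
  head₀-≥ {_ ∷ _} d = ℕ.≤-refl ∷ Decreasing-head d
  push : Carrier (multiples c ×ʷ DecTuples (c + 2) r) → Carrier (DecTuples c (suc r))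
  push (j , μs , length≡ , d) =
    (j + head₀ μs) ∷ μs , cong suc length≡ ,
    Decreasing-∷ (All.map (λ μ≤h → ℕ.≤-trans μ≤h (ℕ.m≤n+m _ j)) (head₀-≥ d)) d
  push-injective : Injective _≡_ _≡_ push
  push-injective {j , μs , _} {j′ , _ , _} eq with ∷-injective (cong proj₁ eq)
  ... | j+h≡j′+h , refl = cong₂ _,_ (ℕ.+-cancelʳ-≡ (head₀ μs) j j′ j+h≡j′+h) (Σ-≡ DecTuple-irrelevant refl)
  push-surjective : StrictlySurjective _≡_ push
  push-surjective ((μ ∷ μs) , length≡ , d) =
    (μ ∸ head₀ μs , μs , ℕ.suc-injective length≡ , Linked.tail d) ,
    Σ-≡ DecTuple-irrelevant (cong (_∷ μs) (ℕ.m∸n+n≡m (head₀≤ μs d)))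
    where
    head₀≤ : ∀ μs → Decreasing (μ ∷ μs) → head₀ μs ≤ μ
    head₀≤ []      _ = z≤n
    head₀≤ (_ ∷ _) d = Linked.head d
  push-weight : ∀ x → headWeighted c (proj₁ (push x)) ≡ weight (multiples c ×ʷ DecTuples (c + 2) r) x
  push-weight (j , [] , _)     = regroup₀ c j
    where
    regroup₀ : ∀ c j → c * (j + 0) + 2 * 0 ≡ j * c + 0
    regroup₀ = ℕ-solve-∀
  push-weight (j , μ ∷ μs , _) = regroup c j μ (sum μs)
    where
    regroup : ∀ c j μ s → c * (j + μ) + 2 * (μ + s) ≡ j * c + ((c + 2) * μ + 2 * s)
    regroup = ℕ-solve-∀

HasGF-DecTuples : ∀ {c} r → 1 ≤ c → HasGF (DecTuples c r) (invPoch c 2 r)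
HasGF-DecTuples zero    _   = HasGF-unit ([] , refl , []) (λ { ([] , refl , []) → refl }) refl
HasGF-DecTuples {c} (suc r) 1≤c = HasGF-≅ (DecTuples-∷ c r)
  (HasGF-≈ (≈-sym (invPoch-∷ c 2 r))
    (HasGF-× (HasGF-multiples 1≤c) (HasGF-DecTuples r (ℕ.≤-trans 1≤c (ℕ.m≤m+n c 2)))))

sum-replicate : ∀ j v → sum (replicate j v) ≡ j * v
sum-replicate zero    v = refl
sum-replicate (suc j) v = cong (_+_ v) (sum-replicate j v)

replicate-decreasing : ∀ n x → Decreasing (replicate n x)
replicate-decreasing zero          x = []
replicate-decreasing (suc zero)    x = [-]
replicate-decreasing (suc (suc n)) x = ℕ.≤-refl ∷ replicate-decreasing (suc n) x

InBox : ℕ → ℕ → List ℕ → Set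
InBox b w νs = length νs ≡ b × Decreasing νs × All (_≤ w) νs

InBox-irrelevant : ∀ {b w νs} → Irrelevant (InBox b w νs)
InBox-irrelevant = ×-irrelevant ℕ.≡-irrelevant (×-irrelevant Decreasing-irrelevant (All.irrelevant ℕ.≤-irrelevant))

Box : ℕ → ℕ → Weighted
Box b w = weighted (Σ (List ℕ) (InBox b w)) (λ (νs , _) → 2 * sum νs)

Box-zero-unique : ∀ {b} (x y : Carrier (Box b 0)) → x ≡ y
Box-zero-unique (νs , l , _ , ≤0) (νs′ , l′ , _ , ≤0′) =
  Σ-≡ InBox-irrelevant (trans (replicate-0 ≤0) (trans (cong₂ replicate (trans l (sym l′)) refl) (sym (replicate-0 ≤0′))))
  where
  replicate-0 : ∀ {νs} → All (_≤ 0) νs → νs ≡ replicate (length νs) 0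
  replicate-0 []          = refl
  replicate-0 (z≤n ∷ ≤0) = cong (0 ∷_) (replicate-0 ≤0)

Box-suc : ∀ b w → Box (suc b) w ⊎ʷ (point (2 + 2 * w) ×ʷ Box b (suc w)) ≅ Box (suc b) (suc w)
Box-suc b w = ≅-bijective embed embed-injective embed-surjective embed-weight
  where
  embed : Carrier (Box (suc b) w ⊎ʷ (point (2 + 2 * w) ×ʷ Box b (suc w))) → Carrier (Box (suc b) (suc w))
  embed (inj₁ (νs , l , d , ≤w))      = νs , l , d , All.map ℕ.m≤n⇒m≤1+n ≤w
  embed (inj₂ (tt , νs , l , d , ≤w)) = suc w ∷ νs , cong suc l , Decreasing-∷ ≤w d , ℕ.≤-refl ∷ ≤w
  embed-injective : Injective _≡_ _≡_ embed
  embed-injective {inj₁ _} {inj₁ _} eq = cong inj₁ (Σ-≡ InBox-irrelevant (cong proj₁ eq))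
  embed-injective {inj₂ _} {inj₂ _} eq = cong (inj₂ ∘ (tt ,_)) (Σ-≡ InBox-irrelevant (∷-injectiveʳ (cong proj₁ eq)))
  embed-injective {inj₁ (_ ∷ _ , _ , _ , ν≤w ∷ _)} {inj₂ _} eq =
    contradiction (subst (_≤ w) (∷-injectiveˡ (cong proj₁ eq)) ν≤w) (ℕ.n≮n w)
  embed-injective {inj₂ _} {inj₁ (_ ∷ _ , _ , _ , ν≤w ∷ _)} eq =
    contradiction (subst (_≤ w) (sym (∷-injectiveˡ (cong proj₁ eq))) ν≤w) (ℕ.n≮n w)
  embed-surjective : StrictlySurjective _≡_ embed
  embed-surjective (ν ∷ νs , l , d , ν≤1+w ∷ ≤1+w) with ν ℕ.≟ suc w
  ... | yes refl = inj₂ (tt , νs , ℕ.suc-injective l , Linked.tail d , ≤1+w) , Σ-≡ InBox-irrelevant refl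
  ... | no  ν≢1+w = inj₁ (ν ∷ νs , l , d , ν≤w ∷ All.map (λ μ≤ν → ℕ.≤-trans μ≤ν ν≤w) (Decreasing-head d)) ,
                    Σ-≡ InBox-irrelevant refl
    where
    ν≤w : ν ≤ w
    ν≤w = ℕ.≤-pred (ℕ.≤∧≢⇒< ν≤1+w ν≢1+w)
  embed-weight : ∀ x → 2 * sum (proj₁ (embed x)) ≡ weight (Box (suc b) w ⊎ʷ (point (2 + 2 * w) ×ʷ Box b (suc w))) x
  embed-weight (inj₁ _)              = refl
  embed-weight (inj₂ (tt , νs , _)) = regroup w (sum νs)
    where
    regroup : ∀ w s → 2 * (suc w + s) ≡ 2 + 2 * w + 2 * s
    regroup = ℕ-solve-∀

HasGF-Box : ∀ b w → HasGF (Box b w) (boxGF b w)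
HasGF-Box zero    w       = HasGF-unit ([] , refl , [] , []) (λ { ([] , refl , [] , []) → refl }) refl
HasGF-Box (suc b) zero    = HasGF-unit x (Box-zero-unique x) (cong (2 *_) (trans (sum-replicate b 0) (ℕ.*-zeroʳ b)))
  where
  x : Carrier (Box (suc b) 0)
  x = replicate (suc b) 0 , length-replicate (suc b) , replicate-decreasing (suc b) 0 , Allₚ.replicate⁺ (suc b) z≤n
HasGF-Box (suc b) (suc w) = HasGF-≅ (Box-suc b w)
  (HasGF-⊎ (HasGF-Box (suc b) w) (HasGF-× (HasGF-point (2 + 2 * w)) (HasGF-Box b (suc w))))

replicate-++-split : ∀ v {xs} → Decreasing xs → All (_≤ v) xs →
                     Σ ℕ λ j → Σ (List ℕ) λ rest → xs ≡ replicate j v ++ rest × All (_< v) rest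
replicate-++-split v {[]}     _ _ = 0 , [] , refl , []
replicate-++-split v {x ∷ xs} d (x≤v ∷ ≤v) with x ℕ.≟ v
... | yes refl = let (j , rest , xs≡ , <v) = replicate-++-split v (Linked.tail d) ≤v in
                 suc j , rest , cong (v ∷_) xs≡ , <v
... | no  x≢v  = 0 , x ∷ xs , refl , x<v ∷ All.map (λ y≤x → ℕ.≤-<-trans y≤x x<v) (Decreasing-head d)
  where
  x<v : x < v
  x<v = ℕ.≤∧≢⇒< x≤v x≢v

replicate-++-injective : ∀ v j j′ {rest rest′} → All (_< v) rest → All (_< v) rest′ →
                         replicate j v ++ rest ≡ replicate j′ v ++ rest′ → j ≡ j′ × rest ≡ rest′
replicate-++-injective v zero     zero     _           _            eq = refl , eq
replicate-++-injective v (suc j)  (suc j′) <v          <v′          eq =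
  let (j≡j′ , rest≡) = replicate-++-injective v j j′ <v <v′ (∷-injectiveʳ eq) in cong suc j≡j′ , rest≡
replicate-++-injective v zero     (suc j′) (x<v ∷ _)   _            eq =
  contradiction (subst (_< v) (∷-injectiveˡ eq) x<v) (ℕ.n≮n v)
replicate-++-injective v (suc j)  zero     _           (x<v ∷ _)    eq =
  contradiction (subst (_< v) (sym (∷-injectiveˡ eq)) x<v) (ℕ.n≮n v)

OddBelow : ℕ → List ℕ → Set
OddBelow R bs = Decreasing bs × All Odd bs × All (_< nthOdd R) bs

OddBelow-irrelevant : ∀ {R bs} → Irrelevant (OddBelow R bs)
OddBelow-irrelevant = ×-irrelevant Decreasing-irrelevant
  (×-irrelevant (All.irrelevant ℕ.≡-irrelevant) (All.irrelevant ℕ.≤-irrelevant))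

SmallOdd : ℕ → Weighted
SmallOdd R = weighted (Σ (List ℕ) (OddBelow R)) (sum ∘ proj₁)

SmallOdd-suc : ∀ R → SmallOdd R ×ʷ multiples (nthOdd R) ≅ SmallOdd (suc R)
SmallOdd-suc R = ≅-bijective prepend prepend-injective prepend-surjective prepend-weight
  where
  v : ℕ
  v = nthOdd R
  v<next : v < nthOdd (suc R)
  v<next = ℕ.n≤1+n (suc v)
  prepend : Carrier (SmallOdd R ×ʷ multiples v) → Carrier (SmallOdd (suc R))
  prepend ((bs , d , odd , <v) , j) =
    replicate j v ++ bs ,
    Decreasing-++ (replicate-decreasing j v) d (Allₚ.replicate⁺ j (All.map ℕ.<⇒≤ <v)) ,
    Allₚ.++⁺ (Allₚ.replicate⁺ j (nthOdd-odd R)) odd ,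
    Allₚ.++⁺ (Allₚ.replicate⁺ j v<next) (All.map (λ b<v → ℕ.<-trans b<v v<next) <v)
  prepend-injective : Injective _≡_ _≡_ prepend
  prepend-injective {(bs , _ , _ , <v) , j} {(bs′ , _ , _ , <v′) , j′} eq
    with replicate-++-injective v j j′ <v <v′ (cong proj₁ eq)
  ... | refl , refl = cong (_, j) (Σ-≡ (OddBelow-irrelevant {R}) refl)
  prepend-surjective : StrictlySurjective _≡_ prepend
  prepend-surjective (bs , d , odd , <next)
    with replicate-++-split v d (All.zipWith (λ (b-odd , b<next) → odd-<-nthOdd-suc {R} b-odd b<next) (odd , <next))
  ... | j , rest , refl , <v = ((rest , proj₂ (Decreasing-++⁻ (replicate j v) d) , Allₚ.++⁻ʳ (replicate j v) odd , <v) , j) ,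
                               Σ-≡ (OddBelow-irrelevant {suc R}) refl
  prepend-weight : ∀ x → sum (proj₁ (prepend x)) ≡ weight (SmallOdd R ×ʷ multiples v) x
  prepend-weight ((bs , _) , j) = begin
    sum (replicate j v ++ bs)           ≡⟨ sum-++ (replicate j v) bs ⟩
    sum (replicate j v) + sum bs        ≡⟨ cong (_+ sum bs) (sum-replicate j v) ⟩
    j * v + sum bs                      ≡⟨ ℕ.+-comm (j * v) (sum bs) ⟩
    sum bs + j * v                      ∎
    where open ≡-Reasoning

HasGF-SmallOdd : ∀ R → HasGF (SmallOdd R) (invPoch 1 2 R)
HasGF-SmallOdd zero    = HasGF-unit ([] , [] , [] , [])
  (λ { ([] , [] , [] , []) → refl ; (_ ∷ _ , _ , () ∷ _ , s≤s z≤n ∷ _) }) refl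
HasGF-SmallOdd (suc R) = HasGF-≅ (SmallOdd-suc R)
  (HasGF-≈ (≈-sym (invPoch-suc 1 2 R))
    (subst (λ a → HasGF (SmallOdd R ×ʷ multiples (nthOdd R)) (invPoch 1 2 R ⊛ invOneMinus a))
      (cong suc (ℕ.*-comm R 2)) (HasGF-× (HasGF-SmallOdd R) (HasGF-multiples (s≤s z≤n)))))

-- Cutting a hook partition at row s

-- An odd part reaches column m iff it is ≥ nthOdd M (with M = ⌊m/2⌋ for either parity of m).
module HookDecomposition (m M : ℕ) (1≤m : 1 ≤ m) (m≤M⁺ : m ≤ nthOdd M)
                         (odd≥m : ∀ {y} → Odd y → m ≤ y → nthOdd M ≤ y) (k r : ℕ) where

  IsHookPartition : List ℕ → Set
  IsHookPartition ps = Decreasing ps × All (1 ≤_) ps × OddParts ps × HookAt m (suc r) k ps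

  IsHookPartition-irrelevant : ∀ {ps} → Irrelevant (IsHookPartition ps)
  IsHookPartition-irrelevant = ×-irrelevant Decreasing-irrelevant (×-irrelevant (All.irrelevant ℕ.≤-irrelevant)
    (×-irrelevant (All.irrelevant ℕ.≡-irrelevant) (×-irrelevant ℕ.≤-irrelevant (×-irrelevant ℕ.≤-irrelevant ℕ.≡-irrelevant))))

  HookPartitions : Weighted
  HookPartitions = weighted (Σ (List ℕ) IsHookPartition) (sum ∘ proj₁)

  -- The paper's l, the number of cells of the hook in row r + 1.
  rowCells : ℕ → ℕ
  rowCells L = suc (nthOdd (M + L)) ∸ m

  exponent : ℕ → ℕ
  exponent L = suc r * nthOdd (M + L) + (k ∸ rowCells L) * nthOdd M

  Pieces : ℕ → Weighted
  Pieces L = point (exponent L) ×ʷ (DecTuples 2 r ×ʷ (SmallOdd M ×ʷ Box (k ∸ rowCells L) L))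

  Decomposed : Weighted
  Decomposed = weighted (Σ (Σ ℕ λ L → rowCells L ≤ k) (Carrier ∘ Pieces ∘ proj₁)) λ ((L , _) , x) → weight (Pieces L) x

  upper : ℕ → List ℕ → List ℕ
  upper L = map (λ μ → nthOdd (M + L + μ))

  middle : List ℕ → List ℕ
  middle = map (λ ν → nthOdd (M + ν))

  -- Row r + 1 is nthOdd (M + L); the rows below it that reach column m are nthOdd (M + ν) with ν ≤ L,
  -- and bs are the parts shorter than m.
  glue : ℕ → List ℕ → List ℕ → List ℕ → List ℕ
  glue L μs νs bs = upper L μs ++ nthOdd (M + L) ∷ (middle νs ++ bs)

  m≤nthOdd : ∀ {a} → M ≤ a → m ≤ nthOdd a
  m≤nthOdd M≤a = ℕ.≤-trans m≤M⁺ (nthOdd-mono-≤ M≤a)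

  M≤M+ : ∀ a → M ≤ M + a
  M≤M+ = ℕ.m≤m+n M

  M≤M+L+ : ∀ L μ → M ≤ M + L + μ
  M≤M+L+ L μ = ℕ.≤-trans (M≤M+ L) (ℕ.m≤m+n (M + L) μ)

  OddBelow⇒<m : ∀ {b} → Odd b → b < nthOdd M → b < m
  OddBelow⇒<m b-odd b<M⁺ = ℕ.≰⇒> (λ m≤b → ℕ.<⇒≱ b<M⁺ (odd≥m b-odd m≤b))

  col-glue : ∀ L μs νs {bs} → OddBelow M bs → col (glue L μs νs bs) m ≡ length μs + suc (length νs)
  col-glue L μs νs {bs} (_ , odd , <M⁺) = begin
    length (filter (m ℕ.≤?_) (upper L μs ++ x ∷ (middle νs ++ bs)))
      ≡⟨ cong length (filter-++ (m ℕ.≤?_) (upper L μs) _) ⟩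
    length (filter (m ℕ.≤?_) (upper L μs) ++ filter (m ℕ.≤?_) (x ∷ (middle νs ++ bs)))
      ≡⟨ cong₂ (λ xs ys → length (xs ++ ys)) (filter-all (m ℕ.≤?_) upper≥m) lower-filtered ⟩
    length (upper L μs ++ x ∷ (middle νs ++ []))
      ≡⟨ length-++ (upper L μs) ⟩
    length (upper L μs) + suc (length (middle νs ++ []))
      ≡⟨ cong₂ (λ a b → a + suc b) (length-map _ μs) (trans (cong length (++-identityʳ (middle νs))) (length-map _ νs)) ⟩
    length μs + suc (length νs) ∎
    where
    open ≡-Reasoning
    x : ℕ
    x = nthOdd (M + L)
    upper≥m : All (m ≤_) (upper L μs)
    upper≥m = Allₚ.map⁺ (All.universal (λ μ → m≤nthOdd (M≤M+L+ L μ)) μs)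
    middle≥m : All (m ≤_) (middle νs)
    middle≥m = Allₚ.map⁺ (All.universal (m≤nthOdd ∘ M≤M+) νs)
    bs≱m : All (λ b → ¬ m ≤ b) bs
    bs≱m = All.zipWith (λ (b-odd , b<M⁺) → ℕ.<⇒≱ (OddBelow⇒<m b-odd b<M⁺)) (odd , <M⁺)
    lower-filtered : filter (m ℕ.≤?_) (x ∷ (middle νs ++ bs)) ≡ x ∷ (middle νs ++ [])
    lower-filtered = begin
      filter (m ℕ.≤?_) (x ∷ (middle νs ++ bs))              ≡⟨ filter-accept (m ℕ.≤?_) (m≤nthOdd (M≤M+ L)) ⟩
      x ∷ filter (m ℕ.≤?_) (middle νs ++ bs)                ≡⟨ cong (x ∷_) (filter-++ (m ℕ.≤?_) (middle νs) bs) ⟩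
      x ∷ (filter (m ℕ.≤?_) (middle νs) ++ filter (m ℕ.≤?_) bs)
        ≡⟨ cong₂ (λ xs ys → x ∷ (xs ++ ys)) (filter-all (m ℕ.≤?_) middle≥m) (filter-none (m ℕ.≤?_) bs≱m) ⟩
      x ∷ (middle νs ++ [])                                 ∎

  row-glue : ∀ L μs νs bs → length μs ≡ r → row (glue L μs νs bs) (suc r) ≡ nthOdd (M + L)
  row-glue L μs νs bs refl = subst (λ n → row (glue L μs νs bs) (suc n) ≡ nthOdd (M + L))
    (length-map _ μs) (row-++-∷ (upper L μs) (nthOdd (M + L)) (middle νs ++ bs))

  hook-glue : ∀ L μs νs {bs} → length μs ≡ r → OddBelow M bs →
              hookLength (glue L μs νs bs) (suc r) m ≡ rowCells L + length νs
  hook-glue L μs νs {bs} refl below = begin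
    (row (glue L μs νs bs) (suc r) + col (glue L μs νs bs) m + 1) ∸ (suc r + m)
      ≡⟨ cong₂ (λ a b → (a + b + 1) ∸ (suc r + m)) (row-glue L μs νs bs refl) (col-glue L μs νs below) ⟩
    (x + (r + suc (length νs)) + 1) ∸ (suc r + m)
      ≡⟨ cong (_∸ (suc r + m)) (regroup x r (length νs)) ⟩
    (suc r + suc x + length νs) ∸ (suc r + m)
      ≡⟨ cong (λ y → (suc r + y + length νs) ∸ (suc r + m)) (sym (ℕ.m+[n∸m]≡n m≤1+x)) ⟩
    (suc r + (m + rowCells L) + length νs) ∸ (suc r + m)
      ≡⟨ cong (_∸ (suc r + m)) (reassoc (suc r) m (rowCells L) (length νs)) ⟩
    (suc r + m + (rowCells L + length νs)) ∸ (suc r + m)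
      ≡⟨ ℕ.m+n∸m≡n (suc r + m) _ ⟩
    rowCells L + length νs ∎
    where
    open ≡-Reasoning
    x = nthOdd (M + L)
    m≤1+x : m ≤ suc x
    m≤1+x = ℕ.m≤n⇒m≤1+n (m≤nthOdd (M≤M+ L))
    regroup : ∀ x r n → x + (r + suc n) + 1 ≡ suc r + suc x + n
    regroup = ℕ-solve-∀
    reassoc : ∀ a b c d → a + (b + c) + d ≡ a + b + (c + d)
    reassoc = ℕ-solve-∀

  Conditions : ℕ → List ℕ → List ℕ → List ℕ → Set
  Conditions L μs νs bs = rowCells L ≤ k × DecTuple r μs × OddBelow M bs × InBox (k ∸ rowCells L) L νs

  Conditions-irrelevant : ∀ {L μs νs bs} → Irrelevant (Conditions L μs νs bs)
  Conditions-irrelevant = ×-irrelevant ℕ.≤-irrelevant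
    (×-irrelevant DecTuple-irrelevant (×-irrelevant (OddBelow-irrelevant {M}) InBox-irrelevant))

  glue-decreasing : ∀ L {μs νs bs} → Decreasing μs → Decreasing νs → All (_≤ L) νs → OddBelow M bs →
                    Decreasing (glue L μs νs bs)
  glue-decreasing L {μs} {νs} {bs} dμ dν ≤L (db , _ , <M⁺) =
    Decreasing-++ (Decreasing-map (λ b≤a → nthOdd-mono-≤ (ℕ.+-monoʳ-≤ (M + L) b≤a)) dμ)
      (Decreasing-∷ lower≤x (Decreasing-++ (Decreasing-map (λ b≤a → nthOdd-mono-≤ (ℕ.+-monoʳ-≤ M b≤a)) dν) db bs≤middle))
      lower≤upper
    where
    bs≤ : ∀ a → All (_≤ nthOdd (M + a)) bs
    bs≤ a = All.map (λ b<M⁺ → ℕ.<⇒≤ (ℕ.<-≤-trans b<M⁺ (nthOdd-mono-≤ (M≤M+ a)))) <M⁺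
    bs≤middle : All (λ y → All (_≤ y) bs) (middle νs)
    bs≤middle = Allₚ.map⁺ (All.universal bs≤ νs)
    lower≤x : All (_≤ nthOdd (M + L)) (middle νs ++ bs)
    lower≤x = Allₚ.++⁺ (Allₚ.map⁺ (All.map (λ ν≤L → nthOdd-mono-≤ (ℕ.+-monoʳ-≤ M ν≤L)) ≤L)) (bs≤ L)
    lower≤upper : All (λ y → All (_≤ y) (nthOdd (M + L) ∷ (middle νs ++ bs))) (upper L μs)
    lower≤upper = Allₚ.map⁺ (All.universal (λ μ → All.map (λ z≤x → ℕ.≤-trans z≤x (nthOdd-mono-≤ (ℕ.m≤m+n (M + L) μ)))
                                                         (ℕ.≤-refl ∷ lower≤x)) μs)

  glue-odd : ∀ L μs νs {bs} → All Odd bs → OddParts (glue L μs νs bs)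
  glue-odd L μs νs odd = Allₚ.++⁺ (Allₚ.map⁺ (All.universal (λ μ → nthOdd-odd (M + L + μ)) μs))
    (nthOdd-odd (M + L) ∷ Allₚ.++⁺ (Allₚ.map⁺ (All.universal (λ ν → nthOdd-odd (M + ν)) νs)) odd)

  glue-hookPartition : ∀ L μs νs bs → Conditions L μs νs bs → IsHookPartition (glue L μs νs bs)
  glue-hookPartition L μs νs bs (lk , (lμ , dμ) , below@(_ , odd , _) , (lν , dν , ≤L)) =
    glue-decreasing L dμ dν ≤L below , All.map odd⇒positive (glue-odd L μs νs odd) , glue-odd L μs νs odd ,
    s≤s z≤n , subst (m ≤_) (sym (row-glue L μs νs bs lμ)) (m≤nthOdd (M≤M+ L)) ,
    trans (hook-glue L μs νs lμ below) (trans (cong (_+_ (rowCells L)) lν) (ℕ.m+[n∸m]≡n lk))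
    where
    odd⇒positive : ∀ {y} → Odd y → 1 ≤ y
    odd⇒positive {suc y} _ = s≤s z≤n

  Glued : List ℕ → Set
  Glued ps = Σ ℕ λ L → Σ (List ℕ) λ μs → Σ (List ℕ) λ νs → Σ (List ℕ) λ bs →
             Conditions L μs νs bs × glue L μs νs bs ≡ ps

  lowerIndices : List ℕ → List ℕ
  lowerIndices rest = map (oddIndex M) (takeWhile (nthOdd M ℕ.≤?_) rest)

  shortParts : List ℕ → List ℕ
  shortParts = dropWhile (nthOdd M ℕ.≤?_)

  split-below-row : ∀ L {rest} → Decreasing rest → All Odd rest → All (_≤ nthOdd (M + L)) rest →
                    middle (lowerIndices rest) ++ shortParts rest ≡ rest × Decreasing (lowerIndices rest) ×
                    All (_≤ L) (lowerIndices rest) × OddBelow M (shortParts rest)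
  split-below-row L {rest} d odd ≤x =
    trans (cong (_++ shortParts rest) (map-nthOdd-oddIndex M (Allₚ.++⁻ˡ long odd′) (Allₚ.all-takeWhile _ rest))) split≡ ,
    Decreasing-map (oddIndex-mono-≤ M) (proj₁ (Decreasing-++⁻ long d′)) ,
    Allₚ.map⁺ (All.map (λ t≤x → subst (_ ≤_) (oddIndex-nthOdd M L) (oddIndex-mono-≤ M t≤x)) (Allₚ.++⁻ˡ long ≤x′)) ,
    proj₂ (Decreasing-++⁻ long d′) , Allₚ.++⁻ʳ long odd′ , dropWhile-≤ (nthOdd M) d
    where
    long : List ℕ
    long = takeWhile (nthOdd M ℕ.≤?_) rest
    split≡ : long ++ shortParts rest ≡ rest
    split≡ = takeWhile++dropWhile (nthOdd M ℕ.≤?_) rest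
    d′ : Decreasing (long ++ shortParts rest)
    d′ = subst Decreasing (sym split≡) d
    odd′ : All Odd (long ++ shortParts rest)
    odd′ = subst (All Odd) (sym split≡) odd
    ≤x′ : All (_≤ nthOdd (M + L)) (long ++ shortParts rest)
    ≤x′ = subst (All (_≤ nthOdd (M + L))) (sym split≡) ≤x

  cut-at-row : ∀ ps → Decreasing ps → OddParts ps → m ≤ row ps (suc r) →
               Σ ℕ λ L → Σ (List ℕ) λ μs → upper L μs ++ nthOdd (M + L) ∷ drop (suc r) ps ≡ ps × DecTuple r μs
  cut-at-row ps d odd m≤y = L , μs , trans (cong₂ _++_ upper≡ (cong (_∷ rest) x≡y)) (sym ps≡) , lμ , dμ
    where
    y : ℕ
    y = row ps (suc r)
    top rest : List ℕ
    top = take r ps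
    rest = drop (suc r) ps
    1≤y : 1 ≤ y
    1≤y = ℕ.≤-trans 1≤m m≤y
    ps≡ : ps ≡ top ++ y ∷ rest
    ps≡ = take-row r ps 1≤y
    d′ : Decreasing (top ++ y ∷ rest)
    d′ = subst Decreasing ps≡ d
    odd′ : All Odd (top ++ y ∷ rest)
    odd′ = subst (All Odd) ps≡ odd
    y-odd : Odd y
    y-odd = All.head (Allₚ.++⁻ʳ top odd′)
    L : ℕ
    L = oddIndex M y
    x≡y : nthOdd (M + L) ≡ y
    x≡y = nthOdd-oddIndex M y-odd (odd≥m y-odd m≤y)
    μs : List ℕ
    μs = map (oddIndex (M + L)) top
    upper≡ : upper L μs ≡ top
    upper≡ = map-nthOdd-oddIndex (M + L) (Allₚ.++⁻ˡ top odd′) (subst (λ x → All (x ≤_) top) (sym x≡y) (Decreasing-++-∷ top d′))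
    lμ : length μs ≡ r
    lμ = trans (length-map _ top) (length-take-row r ps 1≤y)
    dμ : Decreasing μs
    dμ = Decreasing-map (oddIndex-mono-≤ (M + L)) (proj₁ (Decreasing-++⁻ top d′))

  decompose : ∀ ps → IsHookPartition ps → Glued ps
  decompose ps (d , _ , odd , _ , m≤y , hook) with cut-at-row ps d odd m≤y
  ... | L , μs , cut≡ , (lμ , dμ) = assemble (split-below-row L (Linked.tail d-rest) odd-rest (Decreasing-head d-rest))
    where
    rest νs bs : List ℕ
    rest = drop (suc r) ps
    νs = lowerIndices rest
    bs = shortParts rest
    d-rest : Decreasing (nthOdd (M + L) ∷ rest)
    d-rest = proj₂ (Decreasing-++⁻ (upper L μs) (subst Decreasing (sym cut≡) d))
    odd-rest : All Odd rest
    odd-rest = All.tail (Allₚ.++⁻ʳ (upper L μs) (subst (All Odd) (sym cut≡) odd))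
    assemble : middle νs ++ bs ≡ rest × Decreasing νs × All (_≤ L) νs × OddBelow M bs → Glued ps
    assemble (lower≡ , dν , ≤L , below) = L , μs , νs , bs , (lk , (lμ , dμ) , below , (lν , dν , ≤L)) , glue≡
      where
      glue≡ : glue L μs νs bs ≡ ps
      glue≡ = trans (cong (λ xs → upper L μs ++ nthOdd (M + L) ∷ xs) lower≡) cut≡
      hk : rowCells L + length νs ≡ k
      hk = trans (sym (hook-glue L μs νs lμ below)) (trans (cong (λ qs → hookLength qs (suc r) m) glue≡) hook)
      lk : rowCells L ≤ k
      lk = subst (rowCells L ≤_) hk (ℕ.m≤m+n _ _)
      lν : length νs ≡ k ∸ rowCells L
      lν = trans (sym (ℕ.m+n∸m≡n (rowCells L) (length νs))) (cong (_∸ rowCells L) hk)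

  glue-injective : ∀ {L μs νs bs L′ μs′ νs′ bs′} → Conditions L μs νs bs → Conditions L′ μs′ νs′ bs′ →
                   glue L μs νs bs ≡ glue L′ μs′ νs′ bs′ → L ≡ L′ × μs ≡ μs′ × νs ≡ νs′ × bs ≡ bs′
  glue-injective {L} {μs} {νs} {bs} {L′} {μs′} {νs′} {bs′} (_ , (lμ , _) , _ , (lν , _)) (_ , (lμ′ , _) , _ , (lν′ , _)) eq
    with ++-injective (upper L μs) (upper L′ μs′) (length-map-≡ μs μs′ lμ lμ′) eq
  ... | upper≡ , x∷lower≡ with nthOdd-+-cancelˡ M (∷-injectiveˡ x∷lower≡)
  ... | refl with ++-injective (middle νs) (middle νs′) (length-map-≡ νs νs′ lν lν′) (∷-injectiveʳ x∷lower≡)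
  ... | middle≡ , bs≡ = refl , map-injective (nthOdd-+-cancelˡ (M + L)) upper≡ , map-injective (nthOdd-+-cancelˡ M) middle≡ , bs≡

  sum-glue : ∀ L μs νs bs → length μs ≡ r → length νs ≡ k ∸ rowCells L →
             sum (glue L μs νs bs) ≡ exponent L + (headWeighted 2 μs + (sum bs + 2 * sum νs))
  sum-glue L μs νs bs refl lν = begin
    sum (upper L μs ++ x ∷ (middle νs ++ bs))
      ≡⟨ sum-++ (upper L μs) _ ⟩
    sum (upper L μs) + (x + sum (middle νs ++ bs))
      ≡⟨ cong₂ (λ a b → a + (x + b)) (sum-nthOdd (M + L) μs) (sum-++ (middle νs) bs) ⟩
    length μs * x + 2 * sum μs + (x + (sum (middle νs) + sum bs))
      ≡⟨ cong (λ a → length μs * x + 2 * sum μs + (x + (a + sum bs))) (sum-nthOdd M νs) ⟩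
    length μs * x + 2 * sum μs + (x + (length νs * nthOdd M + 2 * sum νs + sum bs))
      ≡⟨ cong (λ n → length μs * x + 2 * sum μs + (x + (n * nthOdd M + 2 * sum νs + sum bs))) lν ⟩
    length μs * x + 2 * sum μs + (x + ((k ∸ rowCells L) * nthOdd M + 2 * sum νs + sum bs))
      ≡⟨ regroup (length μs) x (sum μs) (k ∸ rowCells L) (nthOdd M) (sum νs) (sum bs) ⟩
    exponent L + (2 * sum μs + (sum bs + 2 * sum νs))
      ≡⟨ cong (λ a → exponent L + (a + (sum bs + 2 * sum νs))) (sym (headWeighted-2 μs)) ⟩
    exponent L + (headWeighted 2 μs + (sum bs + 2 * sum νs)) ∎
    where
    open ≡-Reasoning
    x = nthOdd (M + L)
    regroup : ∀ r x a n y b c → r * x + 2 * a + (x + (n * y + 2 * b + c)) ≡ (suc r * x + n * y) + (2 * a + (c + 2 * b))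
    regroup = ℕ-solve-∀
    headWeighted-2 : ∀ μs → headWeighted 2 μs ≡ 2 * sum μs
    headWeighted-2 []       = refl
    headWeighted-2 (μ ∷ μs) = sym (ℕ.*-distribˡ-+ 2 μ (sum μs))

  pack : ∀ L μs νs bs → Conditions L μs νs bs → Carrier Decomposed
  pack L μs νs bs (lk , pμ , pb , pν) = (L , lk) , tt , (μs , pμ) , (bs , pb) , (νs , pν)

  glue-decomposed : Carrier Decomposed → Carrier HookPartitions
  glue-decomposed ((L , lk) , tt , (μs , pμ) , (bs , pb) , (νs , pν)) =
    glue L μs νs bs , glue-hookPartition L μs νs bs (lk , pμ , pb , pν)

  decomposition : Decomposed ≅ HookPartitions
  decomposition = ≅-bijective glue-decomposed injective surjective preserves-weight
    where
    injective : Injective _≡_ _≡_ glue-decomposed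
    injective {(L , lk) , tt , (μs , pμ) , (bs , pb) , (νs , pν)} {(_ , lk′) , tt , (_ , pμ′) , (_ , pb′) , (_ , pν′)} eq
      with glue-injective (lk , pμ , pb , pν) (lk′ , pμ′ , pb′ , pν′) (cong proj₁ eq)
    ... | refl , refl , refl , refl = cong (pack L μs νs bs) (Conditions-irrelevant _ _)
    surjective : StrictlySurjective _≡_ glue-decomposed
    surjective (ps , hp) with decompose ps hp
    ... | L , μs , νs , bs , c , glue≡ = pack L μs νs bs c , Σ-≡ IsHookPartition-irrelevant glue≡
    preserves-weight : ∀ x → sum (proj₁ (glue-decomposed x)) ≡ weight Decomposed x
    preserves-weight ((L , _) , tt , (μs , lμ , _) , (bs , _) , (νs , lν , _)) = sum-glue L μs νs bs lμ lν

  PiecesGF : ℕ → PS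
  PiecesGF L = mono (exponent L) ⊛ (invPoch 2 2 r ⊛ (invPoch 1 2 M ⊛ boxGF (k ∸ rowCells L) L))

  HasGF-Pieces : ∀ L → HasGF (Pieces L) (PiecesGF L)
  HasGF-Pieces L = HasGF-× (HasGF-point (exponent L))
    (HasGF-× (HasGF-DecTuples r (s≤s z≤n)) (HasGF-× (HasGF-SmallOdd M) (HasGF-Box (k ∸ rowCells L) L)))

  Admissible : Set
  Admissible = Σ ℕ λ L → rowCells L ≤ k

  OfWeight-Decomposed : ∀ n → (Σ Admissible λ (L , _) → OfWeight (Pieces L) n) ↔ OfWeight Decomposed n
  OfWeight-Decomposed n = mk↔ₛ′ (λ (L , x , e) → (L , x) , e) (λ ((L , x) , e) → L , x , e) (λ _ → refl) (λ _ → refl)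

  OfWeight-HookPartitions : ∀ n → OfWeight HookPartitions n ↔
                            Σ (List ℕ) λ ps → IsPartitionOf n ps × OddParts ps × HookAt m (suc r) k ps
  OfWeight-HookPartitions n = mk↔ₛ′ (λ ((ps , d , pos , odd , hook) , e) → ps , (d , pos , e) , odd , hook)
                                    (λ (ps , (d , pos , e) , odd , hook) → (ps , d , pos , odd , hook) , e)
                                    (λ _ → refl) (λ _ → refl)

  1≤rowCells : ∀ L → 1 ≤ rowCells L
  1≤rowCells L = ℕ.m<n⇒0<n∸m (s≤s (m≤nthOdd (M≤M+ L)))

  module Summation {P : ℕ → Set} (P? : Decidable P) (P-irrelevant : ∀ {l} → Irrelevant (P l)) (α : ℕ → ℕ)
                   (rowCells-α : ∀ {l} → 1 ≤ l → P l → rowCells (α l) ≡ l) (α-rowCells : ∀ L → α (rowCells L) ≡ L)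
                   (P-rowCells : ∀ L → P (rowCells L)) where

    admissible : (Σ ℕ λ i → i < k × P (suc i)) ↔ Admissible
    admissible = mk↔ₛ′ to from to∘from from∘to
      where
      suc-pred : ∀ {n} → 1 ≤ n → suc (ℕ.pred n) ≡ n
      suc-pred (s≤s _) = refl
      to : (Σ ℕ λ i → i < k × P (suc i)) → Admissible
      to (i , i<k , p) = α (suc i) , subst (_≤ k) (sym (rowCells-α (s≤s z≤n) p)) i<k
      from : Admissible → Σ ℕ λ i → i < k × P (suc i)
      from (L , ≤k) = ℕ.pred (rowCells L) , subst (_≤ k) (sym (suc-pred (1≤rowCells L))) ≤k ,
                      subst P (sym (suc-pred (1≤rowCells L))) (P-rowCells L)
      to∘from : ∀ x → to (from x) ≡ x
      to∘from (L , _) = Σ-≡ ℕ.≤-irrelevant (trans (cong α (suc-pred (1≤rowCells L))) (α-rowCells L))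
      from∘to : ∀ x → from (to x) ≡ x
      from∘to (i , _ , p) = Σ-≡ (×-irrelevant ℕ.≤-irrelevant P-irrelevant) (cong ℕ.pred (rowCells-α (s≤s z≤n) p))

    count : (term : ℕ → PS) → (∀ L → rowCells L ≤ k → term (rowCells L) ≈ PiecesGF L) → ∀ n →
            Counted (Σ (List ℕ) λ ps → IsPartitionOf n ps × OddParts ps × HookAt m (suc r) k ps)
                    (sumPS (map term (filter P? (range1 k))) n)
    count term term≈ n = Counted-≡ (sym coefficient)
      (Counted-↔ fibres (Counted-Σ< k λ i i<k → Counted-×-if (P? (suc i)) P-irrelevant (fibre i i<k)))
      where
      fibre : ∀ i → i < k → P (suc i) → Counted (OfWeight (Pieces (α (suc i))) n) (term (suc i) n)
      fibre i i<k p = Counted-≡ (sym (trans (cong (λ l → term l n) (sym ρα≡)) (term≈ (α (suc i)) (subst (_≤ k) (sym ρα≡) i<k) n)))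
                                (HasGF-Pieces (α (suc i)) n)
        where
        ρα≡ : rowCells (α (suc i)) ≡ suc i
        ρα≡ = rowCells-α (s≤s z≤n) p
      fibres : (Σ ℕ λ i → i < k × (P (suc i) × OfWeight (Pieces (α (suc i))) n)) ↔
               (Σ (List ℕ) λ ps → IsPartitionOf n ps × OddParts ps × HookAt m (suc r) k ps)
      fibres = ↔-trans (mk↔ₛ′ (λ (i , i<k , p , y) → (i , i<k , p) , y) (λ ((i , i<k , p) , y) → i , i<k , p , y)
                              (λ _ → refl) (λ _ → refl))
               (↔-trans (Σ-↔ admissible ↔-refl)
               (↔-trans (OfWeight-Decomposed n)
               (↔-trans (OfWeight-≅ decomposition n) (OfWeight-HookPartitions n))))
      coefficient : sumPS (map term (filter P? (range1 k))) n ≡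
                    sumℤ (map (λ i → if does (P? (suc i)) then term (suc i) n else + 0) (upTo k))
      coefficient = begin
        sumPS (map term (filter P? (range1 k))) n
          ≡⟨ sumPS-map term (filter P? (range1 k)) n ⟩
        sumℤ (map (λ l → term l n) (filter P? (range1 k)))
          ≡⟨ sumℤ-map-filter P? (λ l → term l n) (range1 k) ⟩
        sumℤ (map (λ l → if does (P? l) then term l n else + 0) (map suc (upTo k)))
          ≡⟨ cong sumℤ (sym (map-∘ (upTo k))) ⟩
        sumℤ (map (λ i → if does (P? (suc i)) then term (suc i) n else + 0) (upTo k)) ∎
        where open ≡-Reasoning

-- The two parities of m

HookPartsAt : ℕ → ℕ → ℕ → ℕ → Set
HookPartsAt m k s n = Σ (List ℕ) λ ps → IsPartitionOf n ps × OddParts ps × HookAt m s k ps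

-- The summands of oddGF and evenGF, restated here because Defs keeps them local.
oddGF-summand : ℕ → ℕ → ℕ → ℕ → PS
oddGF-summand m k s l = mono (k + l * (s ∸ 1) + (m ∸ 1) * ((k + s) ∸ l))
  ⊛ (invPoch 2 2 (s ∸ 1) ⊛ (invPoch 1 2 ((m ∸ 1) / 2) ⊛ gauss2 ((k ∸ l) + (l ∸ 1) / 2) (k ∸ l)))

odd-exponent : ∀ M L r d → let l = nthOdd L in
  l + d + l * r + (nthOdd M ∸ 1) * ((l + d + suc r) ∸ l) ≡ suc r * nthOdd (M + L) + ((l + d) ∸ l) * nthOdd M
odd-exponent M L r d = begin
  l + d + l * r + M * 2 * ((l + d + suc r) ∸ l) ≡⟨ cong (λ a → l + d + l * r + M * 2 * a) (+-∸ˡ (suc r)) ⟩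
  l + d + l * r + M * 2 * (d + suc r)           ≡⟨ regroup M L r d ⟩
  suc r * nthOdd (M + L) + d * nthOdd M         ≡⟨ cong (λ a → suc r * nthOdd (M + L) + a * nthOdd M) (sym (ℕ.m+n∸m≡n l d)) ⟩
  suc r * nthOdd (M + L) + ((l + d) ∸ l) * nthOdd M ∎
  where
  open ≡-Reasoning
  l : ℕ
  l = nthOdd L
  +-∸ˡ : ∀ e → (l + d + e) ∸ l ≡ d + e
  +-∸ˡ e = trans (cong (_∸ l) (ℕ.+-assoc l d e)) (ℕ.m+n∸m≡n l (d + e))
  regroup : ∀ M L r d → (1 + L * 2) + d + (1 + L * 2) * r + M * 2 * (d + suc r) ≡ suc r * (1 + (M + L) * 2) + d * (1 + M * 2)
  regroup = ℕ-solve-∀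

hookParts-odd : ∀ M k r n → Counted (HookPartsAt (nthOdd M) k (suc r) n) (oddGF (nthOdd M) k (suc r) n)
hookParts-odd M k r = count (oddGF-summand (nthOdd M) k (suc r)) summand≈
  where
  open HookDecomposition (nthOdd M) M (s≤s z≤n) ℕ.≤-refl (λ _ M⁺≤y → M⁺≤y) k r
  rowCells≡ : ∀ L → rowCells L ≡ nthOdd L
  rowCells≡ L = trans (cong (_∸ M * 2) (split M L)) (ℕ.m+n∸m≡n (M * 2) (nthOdd L))
    where
    split : ∀ M L → 1 + (M + L) * 2 ≡ M * 2 + (1 + L * 2)
    split = ℕ-solve-∀
  open Summation (λ l → l % 2 ℕ.≟ 1) ℕ.≡-irrelevant (_/ 2)
    (λ {l} _ l-odd → trans (rowCells≡ (l / 2)) (sym (odd⇒nthOdd l-odd)))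
    (λ L → trans (cong (_/ 2) (rowCells≡ L)) (nthOdd-half L))
    (λ L → subst Odd (sym (rowCells≡ L)) (nthOdd-odd L))
  summand≈ : ∀ L → rowCells L ≤ k → oddGF-summand (nthOdd M) k (suc r) (rowCells L) ≈
             mono (suc r * nthOdd (M + L) + (k ∸ rowCells L) * nthOdd M)
               ⊛ (invPoch 2 2 r ⊛ (invPoch 1 2 M ⊛ boxGF (k ∸ rowCells L) L))
  summand≈ L l≤k rewrite rowCells≡ L = ⊛-cong exponent≡ (⊛-congʳ (invPoch 2 2 r) (⊛-cong M≡ box≈))
    where
    exponent≡ : mono (k + nthOdd L * r + M * 2 * ((k + suc r) ∸ nthOdd L)) ≈ mono (suc r * nthOdd (M + L) + (k ∸ nthOdd L) * nthOdd M)
    exponent≡ n = cong (λ e → mono e n)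
      (subst (λ k → k + nthOdd L * r + M * 2 * ((k + suc r) ∸ nthOdd L) ≡ suc r * nthOdd (M + L) + (k ∸ nthOdd L) * nthOdd M)
             (ℕ.m+[n∸m]≡n l≤k) (odd-exponent M L r (k ∸ nthOdd L)))
    M≡ : invPoch 1 2 (M * 2 / 2) ≈ invPoch 1 2 M
    M≡ n = cong (λ a → invPoch 1 2 a n) (m*n/n≡m M 2)
    box≈ : gauss2 ((k ∸ nthOdd L) + (L * 2) / 2) (k ∸ nthOdd L) ≈ boxGF (k ∸ nthOdd L) L
    box≈ n = trans (cong (λ a → gauss2 ((k ∸ nthOdd L) + a) (k ∸ nthOdd L) n) (m*n/n≡m L 2)) (gauss2≈boxGF (k ∸ nthOdd L) L n)

evenGF-summand : ℕ → ℕ → ℕ → ℕ → PS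
evenGF-summand m k s l = mono (k + l * (s ∸ 1) + (m ∸ 1) * ((k + s) ∸ l) + (k ∸ l))
  ⊛ (invPoch 2 2 (s ∸ 1) ⊛ (invPoch 1 2 (m / 2) ⊛ gauss2 ((k ∸ l) + (l ∸ 2) / 2) (k ∸ l)))

even-exponent : ∀ M′ L r d → let l = suc (nthOdd L) in
  l + d + l * r + (suc M′ * 2 ∸ 1) * ((l + d + suc r) ∸ l) + ((l + d) ∸ l) ≡
  suc r * nthOdd (suc M′ + L) + ((l + d) ∸ l) * nthOdd (suc M′)
even-exponent M′ L r d = begin
  l + d + l * r + suc (M′ * 2) * ((l + d + suc r) ∸ l) + ((l + d) ∸ l)
    ≡⟨ cong₂ (λ a b → l + d + l * r + suc (M′ * 2) * a + b) (+-∸ˡ (suc r)) (ℕ.m+n∸m≡n l d) ⟩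
  l + d + l * r + suc (M′ * 2) * (d + suc r) + d ≡⟨ regroup M′ L r d ⟩
  suc r * nthOdd (suc M′ + L) + d * nthOdd (suc M′)
    ≡⟨ cong (λ a → suc r * nthOdd (suc M′ + L) + a * nthOdd (suc M′)) (sym (ℕ.m+n∸m≡n l d)) ⟩
  suc r * nthOdd (suc M′ + L) + ((l + d) ∸ l) * nthOdd (suc M′) ∎
  where
  open ≡-Reasoning
  l : ℕ
  l = suc (nthOdd L)
  +-∸ˡ : ∀ e → (l + d + e) ∸ l ≡ d + e
  +-∸ˡ e = trans (cong (_∸ l) (ℕ.+-assoc l d e)) (ℕ.m+n∸m≡n l (d + e))
  regroup : ∀ M′ L r d → (2 + L * 2) + d + (2 + L * 2) * r + (1 + M′ * 2) * (d + suc r) + d ≡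
                         suc r * (1 + (1 + M′ + L) * 2) + d * (1 + (1 + M′) * 2)
  regroup = ℕ-solve-∀

hookParts-even : ∀ M′ k r n → Counted (HookPartsAt (suc M′ * 2) k (suc r) n) (evenGF (suc M′ * 2) k (suc r) n)
hookParts-even M′ k r = count (evenGF-summand m k (suc r)) summand≈
  where
  M m : ℕ
  M = suc M′
  m = M * 2
  odd≥m : ∀ {y} → Odd y → m ≤ y → nthOdd M ≤ y
  odd≥m y-odd m≤y = ℕ.≤∧≢⇒< m≤y λ { refl → contradiction (trans (sym (m*n%n≡0 M 2)) y-odd) λ () }
  open HookDecomposition m M (s≤s z≤n) (ℕ.n≤1+n m) odd≥m k r
  rowCells≡ : ∀ L → rowCells L ≡ suc (nthOdd L)
  rowCells≡ L = trans (cong (_∸ m) (split M L)) (ℕ.m+n∸m≡n m (suc (nthOdd L)))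
    where
    split : ∀ M L → 2 + (M + L) * 2 ≡ M * 2 + (2 + L * 2)
    split = ℕ-solve-∀
  rowCells-α : ∀ {l} → 1 ≤ l → l % 2 ≡ 0 → rowCells ((l ∸ 2) / 2) ≡ l
  rowCells-α {l} 1≤l l-even = trans (rowCells≡ _) (halve (l / 2) (trans (m≡m%n+[m/n]*n l 2) (cong (_+ l / 2 * 2) l-even)))
    where
    halve : ∀ q → l ≡ q * 2 → suc (nthOdd ((l ∸ 2) / 2)) ≡ l
    halve zero    refl = contradiction 1≤l λ ()
    halve (suc q) refl = cong (λ a → suc (nthOdd a)) (m*n/n≡m q 2)
  open Summation (λ l → l % 2 ℕ.≟ 0) ℕ.≡-irrelevant (λ l → (l ∸ 2) / 2) rowCells-α
    (λ L → trans (cong (λ l → (l ∸ 2) / 2) (rowCells≡ L)) (m*n/n≡m L 2))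
    (λ L → trans (cong (_% 2) (rowCells≡ L)) ([m+kn]%n≡m%n 2 L 2))
  summand≈ : ∀ L → rowCells L ≤ k → evenGF-summand m k (suc r) (rowCells L) ≈
             mono (suc r * nthOdd (M + L) + (k ∸ rowCells L) * nthOdd M)
               ⊛ (invPoch 2 2 r ⊛ (invPoch 1 2 M ⊛ boxGF (k ∸ rowCells L) L))
  summand≈ L l≤k rewrite rowCells≡ L = ⊛-cong exponent≡ (⊛-congʳ (invPoch 2 2 r) (⊛-cong M≡ box≈))
    where
    l : ℕ
    l = suc (nthOdd L)
    exponent≡ : mono (k + l * r + suc (M′ * 2) * ((k + suc r) ∸ l) + (k ∸ l)) ≈ mono (suc r * nthOdd (M + L) + (k ∸ l) * nthOdd M)
    exponent≡ n = cong (λ e → mono e n)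
      (subst (λ k → k + l * r + suc (M′ * 2) * ((k + suc r) ∸ l) + (k ∸ l) ≡ suc r * nthOdd (M + L) + (k ∸ l) * nthOdd M)
             (ℕ.m+[n∸m]≡n l≤k) (even-exponent M′ L r (k ∸ l)))
    M≡ : invPoch 1 2 (m / 2) ≈ invPoch 1 2 M
    M≡ n = cong (λ a → invPoch 1 2 a n) (m*n/n≡m M 2)
    box≈ : gauss2 ((k ∸ l) + (L * 2) / 2) (k ∸ l) ≈ boxGF (k ∸ l) L
    box≈ n = trans (cong (λ a → gauss2 ((k ∸ l) + a) (k ∸ l) n) (m*n/n≡m L 2)) (gauss2≈boxGF (k ∸ l) L n)

even⇒suc*2 : ∀ {m} → 1 ≤ m → m % 2 ≡ 0 → Σ ℕ λ M′ → m ≡ suc M′ * 2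
even⇒suc*2 {m} 1≤m m-even with m / 2 | trans (m≡m%n+[m/n]*n m 2) (cong (_+ m / 2 * 2) m-even)
... | zero   | refl = contradiction 1≤m λ ()
... | suc M′ | m≡  = M′ , m≡

hookParts : ∀ m k r → 1 ≤ m →
  (m % 2 ≡ 1 → ∀ n → Counted (HookPartsAt m k (suc r) n) (oddGF m k (suc r) n)) ×
  (m % 2 ≡ 0 → ∀ n → Counted (HookPartsAt m k (suc r) n) (evenGF m k (suc r) n))
hookParts m k r 1≤m =
  (λ m-odd → subst (λ m → ∀ n → Counted (HookPartsAt m k (suc r) n) (oddGF m k (suc r) n))
                   (sym (odd⇒nthOdd m-odd)) (hookParts-odd (m / 2) k r)) ,
  (λ m-even → let (M′ , m≡) = even⇒suc*2 1≤m m-even in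
              subst (λ m → ∀ n → Counted (HookPartsAt m k (suc r) n) (evenGF m k (suc r) n))
                    (sym m≡) (hookParts-even M′ k r))

sOf-suc : ∀ k h → h ℤ.≤ + k ℤ.- + 1 → Σ ℕ λ r → sOf k h ≡ suc r
sOf-suc k h h≤k-1 = positive {+ k ℤ.- h} (subst (ℤ._≤_ (+ 0)) (swap (+ k) h) (ℤ.i≤j⇒0≤j-i h≤k-1))
  where
  swap : ∀ a b → a ℤ.- + 1 ℤ.- b ≡ a ℤ.- b ℤ.- + 1
  swap = solve-∀
  positive : ∀ {d} → + 0 ℤ.≤ d ℤ.- + 1 → Σ ℕ λ r → ℤ.∣ d ∣ ≡ suc r
  positive {ℤ.+[1+ r ]} _ = r , refl
  positive {+ zero}     ()
  positive {ℤ.-[1+ _ ]} ()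

theorem3p3 : (m k : ℕ) (h : ℤ) → 1 ≤ m → 1 ≤ k → h ℤ.≤ + k ℤ.- + 1 →
    (m % 2 ≡ 1 → (n : ℕ) → Σ ℕ λ N →
      (+ N ≡ oddGF m k (sOf k h) n) × (Fin N ↔ HookParts m k h n)) ×
    (m % 2 ≡ 0 → (n : ℕ) → Σ ℕ λ N →
      (+ N ≡ evenGF m k (sOf k h) n) × (Fin N ↔ HookParts m k h n))
theorem3p3 m k h 1≤m _ h≤k-1 =
  let (r , s≡1+r) = sOf-suc k h h≤k-1 in
  subst (λ s → (m % 2 ≡ 1 → ∀ n → Counted (HookPartsAt m k s n) (oddGF m k s n)) ×
               (m % 2 ≡ 0 → ∀ n → Counted (HookPartsAt m k s n) (evenGF m k s n)))
        (sym s≡1+r) (hookParts m k r 1≤m)
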